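{- The following twelve mesh patterns $(12,R)$ are pairwise equidistributed, where $R$ ranges over: $\{(0,2),(1,2),(2,2),(0,1),(2,1),(0,0),(1,0)\}$, $\{(1,2),(2,2),(0,1),(2,1),(0,0),(1,0),(2,0)\}$, $\{(0,2),(1,2),(2,2),(1,1),(2,1),(0,0),(1,0)\}$, $\{(0,2),(2,2),(0,1),(1,1),(2,1),(0,0),(1,0)\}$, $\{(1,2),(2,2),(0,1),(1,1),(0,0),(2,1),(2,0)\}$, $\{(1,2),(2,2),(0,1),(1,1),(0,0),(1,0),(2,0)\}$, $\{(0,2),(1,2),(2,2),(1,1),(0,1),(0,0),(2,0)\}$, $\{(0,2),(2,2),(1,1),(2,1),(0,0),(1,0),(2,0)\}$, $\{(0,2),(1,2),(0,1),(1,1),(2,1),(0,0),(2,0)\}$, $\{(0,2),(1,2),(1,1),(0,1),(2,2),(1,0),(2,0)\}$, $\{(0,2),(2,2),(0,1),(1,1),(2,1),(1,0),(2,0)\}$, $\{(0,2),(1,2),(1,1),(2,1),(0,0),(1,0),(2,0)\}$. Moreover, for each such pattern $p$ and each $n\ge 1$, $$\sum_{\pi\in S_n}q^{p(\pi)}=n!-\sum_{i=1}^{n-1}(i-1)!(n-i-1)!+q\sum_{i=1}^{n-1}(i-1)!(n-i-1)!.$$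
   Context: For $R\subseteq\{0,1,2\}^2$ and $\pi=\pi_1\cdots\pi_n\in S_n$, an occurrence of the mesh pattern $(12,R)$ in $\pi$ is a pair of positions $i_1<i_2$ with $\pi_{i_1}<\pi_{i_2}$ such that, setting $x_0=0,x_1=i_1,x_2=i_2,x_3=n+1$ and $y_0=0,y_1=\pi_{i_1},y_2=\pi_{i_2},y_3=n+1$, for every $(a,b)\in R$ there is no index $k$ with $x_a<k<x_{a+1}$ and $y_b<\pi_k<y_{b+1}$. $p(\pi)$ is the number of occurrences of $p$ in $\pi$; $s_{n,k}(p)$ the number of $\pi\in S_n$ with $p(\pi)=k$; $p_1,p_2$ are equidistributed if $s_{n,k}(p_1)=s_{n,k}(p_2)$ for all $n,k\ge 0$. -}

module Defs where

open import Data.Nat using (ℕ; zero; suc; _+_; _*_; _∸_; _^_; _!; _<ᵇ_; _≡ᵇ_)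
open import Data.Bool using (Bool; true; false; _∧_; _∨_; not)
open import Data.List using (List; []; _∷_; map; filter; length; concatMap; upTo)
open import Data.Bool.ListAction using (all; any)
open import Data.Nat.ListAction using (sum)
open import Data.Fin using (Fin; zero; suc; toℕ)
open import Data.Product using (_×_; _,_; proj₁; proj₂)
open import Relation.Binary.PropositionalEquality using (_≡_)
open import Data.Bool using (T)
open import Relation.Nullary.Decidable using (Dec)
open import Data.Bool.Properties using (T?)

-- A word is a list of naturals; position k (1-indexed) holds value at k.
-- Permutations of [n] are the words of length n over {1,…,n} with distinct letters.

range1 : ℕ → List ℕ
range1 n = map suc (upTo n)

words : ℕ → ℕ → List (List ℕ)
words zero    n = [] ∷ []
words (suc m) n = concatMap (λ a → map (a ∷_) (words m n)) (range1 n)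

-- 1-indexed access (0 outside range; never used outside range)
at : List ℕ → ℕ → ℕ
at []       _             = 0
at (x ∷ xs) zero          = 0
at (x ∷ xs) (suc zero)    = x
at (x ∷ xs) (suc (suc k)) = at xs (suc k)

distinct : List ℕ → Bool
distinct []       = true
distinct (x ∷ xs) = not (any (x ≡ᵇ_) xs) ∧ distinct xs

perms : ℕ → List (List ℕ)
perms n = filter (λ w → T? (distinct w)) (words n n)

-- mesh patterns (12, R), R ⊆ {0,1,2}²
MeshR : Set
MeshR = List (Fin 3 × Fin 3)

-- the boundaries x₀,…,x₃ (or y₀,…,y₃), given the middle two and n
bnd : ℕ → ℕ → ℕ → Fin 3 → ℕ × ℕ
bnd n u v zero             = 0 , u
bnd n u v (suc zero)       = u , v
bnd n u v (suc (suc zero)) = v , suc n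

_<ᵇ_<ᵇ_ : ℕ → ℕ → ℕ → Bool
a <ᵇ b <ᵇ c = (a <ᵇ b) ∧ (b <ᵇ c)

boxEmpty : List ℕ → ℕ → ℕ → Fin 3 × Fin 3 → Bool
boxEmpty π i₁ i₂ (a , b) =
  not (any (λ k → (proj₁ xs <ᵇ k <ᵇ proj₂ xs) ∧ (proj₁ ys <ᵇ at π k <ᵇ proj₂ ys)) (range1 n))
  where
    n = length π
    xs = bnd n i₁ i₂ a
    ys = bnd n (at π i₁) (at π i₂) b

isOcc : MeshR → List ℕ → ℕ → ℕ → Bool
isOcc R π i₁ i₂ = (i₁ <ᵇ i₂) ∧ (at π i₁ <ᵇ at π i₂) ∧ all (boxEmpty π i₁ i₂) R

occ : MeshR → List ℕ → ℕ
occ R π = length (filter (λ ij → T? (isOcc R π (proj₁ ij) (proj₂ ij)))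
                   (concatMap (λ i → map (i ,_) (range1 n)) (range1 n)))
  where n = length π

s : MeshR → ℕ → ℕ → ℕ
s R n k = length (filter (λ π → T? (occ R π ≡ᵇ k)) (perms n))

Equidistributed : MeshR → MeshR → Set
Equidistributed R₁ R₂ = ∀ n k → s R₁ n k ≡ s R₂ n k

genPoly : MeshR → ℕ → ℕ → ℕ
genPoly R n q = sum (map (λ π → q ^ occ R π) (perms n))

A : ℕ → ℕ
A n = sum (map (λ i → (i ∸ 1) ! * (n ∸ i ∸ 1) !) (range1 (n ∸ 1)))

c0 c1 c2 : Fin 3
c0 = zero
c1 = suc zero
c2 = suc (suc zero)

patt : Fin 12 → MeshR
patt zero = (c0 , c2) ∷ (c1 , c2) ∷ (c2 , c2) ∷ (c0 , c1) ∷ (c2 , c1) ∷ (c0 , c0) ∷ (c1 , c0) ∷ []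
patt (suc zero) = (c1 , c2) ∷ (c2 , c2) ∷ (c0 , c1) ∷ (c2 , c1) ∷ (c0 , c0) ∷ (c1 , c0) ∷ (c2 , c0) ∷ []
patt (suc (suc zero)) = (c0 , c2) ∷ (c1 , c2) ∷ (c2 , c2) ∷ (c1 , c1) ∷ (c2 , c1) ∷ (c0 , c0) ∷ (c1 , c0) ∷ []
patt (suc (suc (suc zero))) = (c0 , c2) ∷ (c2 , c2) ∷ (c0 , c1) ∷ (c1 , c1) ∷ (c2 , c1) ∷ (c0 , c0) ∷ (c1 , c0) ∷ []
patt (suc (suc (suc (suc zero)))) = (c1 , c2) ∷ (c2 , c2) ∷ (c0 , c1) ∷ (c1 , c1) ∷ (c0 , c0) ∷ (c2 , c1) ∷ (c2 , c0) ∷ []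
patt (suc (suc (suc (suc (suc zero))))) = (c1 , c2) ∷ (c2 , c2) ∷ (c0 , c1) ∷ (c1 , c1) ∷ (c0 , c0) ∷ (c1 , c0) ∷ (c2 , c0) ∷ []
patt (suc (suc (suc (suc (suc (suc zero)))))) = (c0 , c2) ∷ (c1 , c2) ∷ (c2 , c2) ∷ (c1 , c1) ∷ (c0 , c1) ∷ (c0 , c0) ∷ (c2 , c0) ∷ []
patt (suc (suc (suc (suc (suc (suc (suc zero))))))) = (c0 , c2) ∷ (c2 , c2) ∷ (c1 , c1) ∷ (c2 , c1) ∷ (c0 , c0) ∷ (c1 , c0) ∷ (c2 , c0) ∷ []
patt (suc (suc (suc (suc (suc (suc (suc (suc zero)))))))) = (c0 , c2) ∷ (c1 , c2) ∷ (c0 , c1) ∷ (c1 , c1) ∷ (c2 , c1) ∷ (c0 , c0) ∷ (c2 , c0) ∷ []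
patt (suc (suc (suc (suc (suc (suc (suc (suc (suc zero))))))))) = (c0 , c2) ∷ (c1 , c2) ∷ (c1 , c1) ∷ (c0 , c1) ∷ (c2 , c2) ∷ (c1 , c0) ∷ (c2 , c0) ∷ []
patt (suc (suc (suc (suc (suc (suc (suc (suc (suc (suc zero)))))))))) = (c0 , c2) ∷ (c2 , c2) ∷ (c0 , c1) ∷ (c1 , c1) ∷ (c2 , c1) ∷ (c1 , c0) ∷ (c2 , c0) ∷ []
patt (suc (suc (suc (suc (suc (suc (suc (suc (suc (suc (suc zero))))))))))) = (c0 , c2) ∷ (c1 , c2) ∷ (c1 , c1) ∷ (c2 , c1) ∷ (c0 , c0) ∷ (c1 , c0) ∷ (c2 , c0) ∷ []

-- Each of the twelve sets R consists of all boxes but two, (a₁ , b₁) and (a₂ , b₂), lying in different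
-- columns and different rows; let c and r be the column and the row meeting neither, so that c ≢ r.
-- Cut a permutation at positions i < j as u₀ v₁ u₁ v₂ u₂.  Then (i , j) is an occurrence iff v₁ < v₂
-- and every block u_a is an injective word whose letters lie in the free row of column a (so u_c = []).
-- Counting such words block by block, the number of permutations with an occurrence at (i , j) is zero
-- unless column c is empty, and then the row sizes are forced and it is |u_a₁|! |u_a₂|!; summed over
-- (i , j) this gives A n for each c.  Conversely an occurrence forces column c and row r to be empty,
-- and as c ≢ r these two conditions determine (i , j).  So p(π) ≤ 1, and p is a 0/1-statistic whose
-- total over the n! permutations is A n.

module Submission where

open import Defs
open import Data.Nat using (ℕ; zero; suc; _+_; _*_; _∸_; _^_; _!; _≤_; _<_; _≤?_; _<?_; _<ᵇ_; _≡ᵇ_; z≤n; s≤s; s≤s⁻¹; _≟_)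
open import Data.Nat.Properties
open import Data.Bool using (Bool; true; false; _∧_; _∨_; not; T)
open import Data.Bool.Properties using (T?; T-∧; T-≡; ∧-zeroʳ; ∧-identityʳ; ∨-assoc; ∨-identityʳ)
open import Function.Bundles using (Equivalence; _⇔_; mk⇔)
open import Data.Bool.ListAction using (all; any)
open import Data.List using (List; []; _∷_; _++_; [_]; map; filter; length; concatMap; upTo; applyUpTo; allFin; cartesianProduct)
open import Data.List.Properties using (map-++; upTo-∷ʳ; length-++; map-upTo)
open import Data.List.Relation.Unary.All as All using (All; []; _∷_)
open import Data.Nat.ListAction using (sum)
open import Data.Fin using (Fin; zero; suc)
import Data.Fin as Fin
open import Data.List.Membership.Propositional using (_∈_)
open import Data.List.Membership.Propositional.Properties
  using (∈-allFin; ∈-++⁺ˡ; ∈-++⁺ʳ; ∈-++⁻; ∈-filter⁻; ∈-cartesianProduct⁻; ∈-map⁺; ∈-applyUpTo⁺; ∈-concat⁺′)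
open import Data.List.Relation.Unary.Any using (here; there; any?)
open import Data.List.Relation.Unary.Unique.Propositional using (Unique; []; _∷_)
import Data.List.Relation.Unary.Unique.Propositional.Properties as Unique
open import Data.List.Relation.Binary.Disjoint.Propositional using (Disjoint)
import Data.List.Relation.Unary.All.Properties as AllP
open import Data.List.Relation.Unary.All.Properties using (all⁺; all⁻; ¬Any⇒All¬; All¬⇒¬Any)
open import Data.List.Relation.Unary.Any.Properties using (any⁺; any⁻)
open import Data.Maybe using (Maybe; just; nothing)
import Data.Maybe.Properties as Maybe
open import Data.Product.Properties using (≡-dec)
open import Data.Product using (_×_; _,_; proj₁; proj₂; ∃-syntax)
open import Data.Sum using (_⊎_; inj₁; inj₂)
open import Data.Unit using (tt)
open import Data.Empty using (⊥-elim)
open import Relation.Nullary using (¬_; yes; no; Dec; isYes; ¬?)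
open import Relation.Nullary.Decidable using (dec-true; dec-false; map′; _×-dec_; _→-dec_; toWitness)
open import Relation.Binary using (tri<; tri≈; tri>; DecidableEquality)
open import Relation.Binary.PropositionalEquality hiding ([_])
open import Function using (_∘′_)
open import Algebra.Properties.CommutativeSemigroup +-commutativeSemigroup using (interchange)

∑ : {A : Set} → List A → (A → ℕ) → ℕ
∑ []       f = 0
∑ (x ∷ xs) f = f x + ∑ xs f

⟦_⟧ : Bool → ℕ
⟦ true  ⟧ = 1
⟦ false ⟧ = 0

⟦∧⟧ : ∀ a b → ⟦ a ∧ b ⟧ ≡ ⟦ a ⟧ * ⟦ b ⟧
⟦∧⟧ true  b = sym (+-identityʳ ⟦ b ⟧)
⟦∧⟧ false b = refl

module _ {A : Set} where

  sum-map : (xs : List A) (f : A → ℕ) → sum (map f xs) ≡ ∑ xs f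
  sum-map []       f = refl
  sum-map (x ∷ xs) f = cong (f x +_) (sum-map xs f)

  length-filter : (xs : List A) (p : A → Bool) → length (filter (λ x → T? (p x)) xs) ≡ ∑ xs (⟦_⟧ ∘′ p)
  length-filter []       p = refl
  length-filter (x ∷ xs) p with p x
  ... | true  = cong suc (length-filter xs p)
  ... | false = length-filter xs p

  ∑-filter : (xs : List A) (p : A → Bool) (f : A → ℕ) → ∑ (filter (λ x → T? (p x)) xs) f ≡ ∑ xs (λ x → ⟦ p x ⟧ * f x)
  ∑-filter []       p f = refl
  ∑-filter (x ∷ xs) p f with p x
  ... | true  = cong₂ _+_ (sym (+-identityʳ (f x))) (∑-filter xs p f)
  ... | false = ∑-filter xs p f

  ∑-++ : (xs ys : List A) (f : A → ℕ) → ∑ (xs ++ ys) f ≡ ∑ xs f + ∑ ys f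
  ∑-++ []       ys f = refl
  ∑-++ (x ∷ xs) ys f = trans (cong (f x +_) (∑-++ xs ys f)) (sym (+-assoc (f x) _ _))

  ∑-cong : (xs : List A) {f g : A → ℕ} → (∀ x → f x ≡ g x) → ∑ xs f ≡ ∑ xs g
  ∑-cong []       eq = refl
  ∑-cong (x ∷ xs) eq = cong₂ _+_ (eq x) (∑-cong xs eq)

  ∑-cong-All : {P : A → Set} {xs : List A} → All P xs → {f g : A → ℕ} → (∀ {x} → P x → f x ≡ g x) → ∑ xs f ≡ ∑ xs g
  ∑-cong-All []         eq = refl
  ∑-cong-All (px ∷ pxs) eq = cong₂ _+_ (eq px) (∑-cong-All pxs eq)

  ∑-zero : (xs : List A) → ∑ xs (λ _ → 0) ≡ 0
  ∑-zero []       = refl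
  ∑-zero (x ∷ xs) = ∑-zero xs

  ∑-+ : (xs : List A) (f g : A → ℕ) → ∑ xs (λ x → f x + g x) ≡ ∑ xs f + ∑ xs g
  ∑-+ []       f g = refl
  ∑-+ (x ∷ xs) f g = trans (cong (f x + g x +_) (∑-+ xs f g)) (interchange (f x) (g x) (∑ xs f) (∑ xs g))

  ∑-*ˡ : (xs : List A) (c : ℕ) (f : A → ℕ) → ∑ xs (λ x → c * f x) ≡ c * ∑ xs f
  ∑-*ˡ []       c f = sym (*-zeroʳ c)
  ∑-*ˡ (x ∷ xs) c f = trans (cong (c * f x +_) (∑-*ˡ xs c f)) (sym (*-distribˡ-+ c (f x) (∑ xs f)))

  ∑-*ʳ : (xs : List A) (c : ℕ) (f : A → ℕ) → ∑ xs (λ x → f x * c) ≡ ∑ xs f * c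
  ∑-*ʳ xs c f = trans (∑-cong xs (λ x → *-comm (f x) c)) (trans (∑-*ˡ xs c f) (*-comm c (∑ xs f)))

  ∑-≥ : ∀ {xs : List A} {x} (f : A → ℕ) → x ∈ xs → f x ≤ ∑ xs f
  ∑-≥ f (here refl)  = m≤m+n _ _
  ∑-≥ f (there x∈xs) = ≤-trans (∑-≥ f x∈xs) (m≤n+m _ _)

module _ {A B : Set} where

  ∑-map : (xs : List A) (g : A → B) (f : B → ℕ) → ∑ (map g xs) f ≡ ∑ xs (f ∘′ g)
  ∑-map []       g f = refl
  ∑-map (x ∷ xs) g f = cong (f (g x) +_) (∑-map xs g f)

  ∑-concatMap : (xs : List A) (g : A → List B) (f : B → ℕ) → ∑ (concatMap g xs) f ≡ ∑ xs (λ x → ∑ (g x) f)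
  ∑-concatMap []       g f = refl
  ∑-concatMap (x ∷ xs) g f = trans (∑-++ (g x) (concatMap g xs) f) (cong (∑ (g x) f +_) (∑-concatMap xs g f))

  ∑-comm : (xs : List A) (ys : List B) (f : A → B → ℕ) → ∑ xs (λ x → ∑ ys (f x)) ≡ ∑ ys (λ y → ∑ xs (λ x → f x y))
  ∑-comm []       ys f = sym (∑-zero ys)
  ∑-comm (x ∷ xs) ys f = trans (cong (∑ ys (f x) +_) (∑-comm xs ys f)) (sym (∑-+ ys (f x) _))

module _ {A : Set} where

  all-∧ : (P Q : A → Bool) (xs : List A) → all (λ x → P x ∧ Q x) xs ≡ all P xs ∧ all Q xs
  all-∧ P Q []       = refl
  all-∧ P Q (x ∷ xs) rewrite all-∧ P Q xs with P x | Q x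
  ... | true  | true  = refl
  ... | true  | false = sym (∧-zeroʳ (all P xs))
  ... | false | _     = refl

  not-any : (P : A → Bool) (xs : List A) → not (any P xs) ≡ all (not ∘′ P) xs
  not-any P []       = refl
  not-any P (x ∷ xs) with P x
  ... | true  = refl
  ... | false = not-any P xs

  any-cong : {P Q : A → Bool} (xs : List A) → (∀ x → P x ≡ Q x) → any P xs ≡ any Q xs
  any-cong []       eq = refl
  any-cong (x ∷ xs) eq = cong₂ _∨_ (eq x) (any-cong xs eq)

  all-cong : {P Q : A → Bool} (xs : List A) → (∀ x → P x ≡ Q x) → all P xs ≡ all Q xs
  all-cong []       eq = refl
  all-cong (x ∷ xs) eq = cong₂ _∧_ (eq x) (all-cong xs eq)

any-map : {A B : Set} (P : B → Bool) (g : A → B) (xs : List A) → any P (map g xs) ≡ any (P ∘′ g) xs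
any-map P g []       = refl
any-map P g (x ∷ xs) = cong (P (g x) ∨_) (any-map P g xs)

T-not : ∀ {x} → T (not x) ⇔ (¬ T x)
T-not {true}  = mk⇔ (λ ()) (λ ¬t → ¬t tt)
T-not {false} = mk⇔ (λ _ ()) (λ _ → tt)

T-notAny⇔All¬ : ∀ {A : Set} (p : A → Bool) xs → T (not (any p xs)) ⇔ All (λ x → ¬ T (p x)) xs
T-notAny⇔All¬ p xs = mk⇔ (λ t → ¬Any⇒All¬ xs (Equivalence.to T-not t ∘′ any⁺ p))
                          (λ ¬ps → Equivalence.from T-not (All¬⇒¬Any ¬ps ∘′ any⁻ p xs))

T-injective : ∀ {x y} → (T x → T y) → (T y → T x) → x ≡ y
T-injective {true}  {true}  _ _ = refl
T-injective {true}  {false} f _ = ⊥-elim (f tt)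
T-injective {false} {true}  _ g = ⊥-elim (g tt)
T-injective {false} {false} _ _ = refl

notAny⇒All≢ : ∀ x ys → T (not (any (x ≡ᵇ_) ys)) → All (x ≢_) ys
notAny⇒All≢ x []       _ = []
notAny⇒All≢ x (y ∷ ys) t with x ≡ᵇ y in eq
... | false = (λ x≡y → subst T eq (≡⇒≡ᵇ x y x≡y)) ∷ notAny⇒All≢ x ys t

All≢⇒notAny : ∀ x ys → All (x ≢_) ys → T (not (any (x ≡ᵇ_) ys))
All≢⇒notAny x []       []           = tt
All≢⇒notAny x (y ∷ ys) (x≢y ∷ x∉ys) rewrite dec-false (x ≟ y) x≢y = All≢⇒notAny x ys x∉ys

distinct⇒Unique : ∀ w → T (distinct w) → Unique w
distinct⇒Unique []       _ = []
distinct⇒Unique (x ∷ xs) t = let (x∉xs , d) = Equivalence.to T-∧ t in notAny⇒All≢ x xs x∉xs ∷ distinct⇒Unique xs d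

Unique⇒distinct : ∀ {w} → Unique w → T (distinct w)
Unique⇒distinct {[]}     []           = tt
Unique⇒distinct {x ∷ xs} (x∉xs ∷ uxs) = Equivalence.from T-∧ (All≢⇒notAny x xs x∉xs , Unique⇒distinct uxs)

Unique-++⁻ : ∀ {A : Set} (xs : List A) {ys} → Unique (xs ++ ys) → Unique xs × Unique ys × Disjoint xs ys
Unique-++⁻ []       u            = [] , u , λ ()
Unique-++⁻ (x ∷ xs) (x∉ ∷ u) with Unique-++⁻ xs u
... | uxs , uys , disj = AllP.++⁻ˡ xs x∉ ∷ uxs , uys , λ where
  (here refl , y∈ys) → All.lookup (AllP.++⁻ʳ xs x∉) y∈ys refl
  (there y∈xs , y∈ys) → disj (y∈xs , y∈ys)

length≤1 : ∀ {A : Set} {xs : List A} → Unique xs → (∀ {x y} → x ∈ xs → y ∈ xs → x ≡ y) → length xs ≤ 1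
length≤1 {xs = []}         _                   _    = z≤n
length≤1 {xs = _ ∷ []}     _                   _    = ≤-refl
length≤1 {xs = _ ∷ _ ∷ _} ((x≢y ∷ _) ∷ _) same = ⊥-elim (x≢y (same (here refl) (there (here refl))))

pairs≡cartesianProduct : ∀ {A B : Set} (xs : List A) (ys : List B) → concatMap (λ x → map (x ,_) ys) xs ≡ cartesianProduct xs ys
pairs≡cartesianProduct []       ys = refl
pairs≡cartesianProduct (x ∷ xs) ys = cong (map (x ,_) ys ++_) (pairs≡cartesianProduct xs ys)

_∈[1,_] : ℕ → ℕ → Set
x ∈[1, n ] = 1 ≤ x × x ≤ n

range1-suc : ∀ n → range1 (suc n) ≡ range1 n ++ [ suc n ]
range1-suc n = trans (cong (map suc) (sym (upTo-∷ʳ n))) (map-++ suc (upTo n) [ n ])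

range1-cons : ∀ m → range1 (suc m) ≡ 1 ∷ map suc (range1 m)
range1-cons m = cong (λ xs → 1 ∷ map suc xs) (sym (map-upTo suc m))

range1-∈ : ∀ n → All (_∈[1, n ]) (range1 n)
range1-∈ zero    = []
range1-∈ (suc n) rewrite range1-suc n =
  AllP.++⁺ (All.map (λ (1≤x , x≤n) → 1≤x , m≤n⇒m≤1+n x≤n) (range1-∈ n)) ((s≤s z≤n , ≤-refl) ∷ [])

∈-range1 : ∀ {n x} → x ∈[1, n ] → x ∈ range1 n
∈-range1 {n} {suc x} (_ , x<n) = ∈-map⁺ suc (∈-applyUpTo⁺ (λ k → k) x<n)

Unique-range1 : ∀ n → Unique (range1 n)
Unique-range1 n = Unique.map⁺ suc-injective (Unique.upTo⁺ n)

∑-range1-suc : ∀ n (f : ℕ → ℕ) → ∑ (range1 (suc n)) f ≡ ∑ (range1 n) f + f (suc n)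
∑-range1-suc n f = trans (cong (λ xs → ∑ xs f) (range1-suc n))
  (trans (∑-++ (range1 n) [ suc n ] f) (cong (∑ (range1 n) f +_) (+-identityʳ (f (suc n)))))

∑-range1-cons : ∀ m (f : ℕ → ℕ) → ∑ (range1 (suc m)) f ≡ f 1 + ∑ (range1 m) (f ∘′ suc)
∑-range1-cons m f = trans (cong (λ xs → ∑ xs f) (range1-cons m)) (cong (f 1 +_) (∑-map (range1 m) suc f))

∑-range1-cong : ∀ n {f g : ℕ → ℕ} → (∀ {x} → x ∈[1, n ] → f x ≡ g x) → ∑ (range1 n) f ≡ ∑ (range1 n) g
∑-range1-cong n = ∑-cong-All (range1-∈ n)

∑-range1-zero : ∀ n (f : ℕ → ℕ) → (∀ {x} → x ∈[1, n ] → f x ≡ 0) → ∑ (range1 n) f ≡ 0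
∑-range1-zero n f eq = trans (∑-range1-cong n eq) (∑-zero (range1 n))

∑-range1-single : ∀ n (f : ℕ → ℕ) {a} → a ∈[1, n ] → (∀ {x} → x ∈[1, n ] → x ≢ a → f x ≡ 0) → ∑ (range1 n) f ≡ f a
∑-range1-single zero    f (1≤a , a≤0) _ = ⊥-elim (<⇒≱ 1≤a a≤0)
∑-range1-single (suc n) f {a} (1≤a , a≤n+1) off with m≤n⇒m<n∨m≡n a≤n+1
... | inj₁ a<n+1 = trans (∑-range1-suc n f)
  (trans (cong₂ _+_ (∑-range1-single n f (1≤a , ≤-pred a<n+1) (λ (1≤x , x≤n) → off (1≤x , m≤n⇒m≤1+n x≤n)))
                    (off (s≤s z≤n , ≤-refl) (λ n+1≡a → <⇒≢ a<n+1 (sym n+1≡a))))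
         (+-identityʳ (f a)))
... | inj₂ refl  = trans (∑-range1-suc n f)
  (cong (_+ f (suc n)) (∑-range1-zero n f (λ (1≤x , x≤n) → off (1≤x , m≤n⇒m≤1+n x≤n) (<⇒≢ (s≤s x≤n)))))

∑-range1-single₂ : ∀ n (t : ℕ → ℕ → ℕ) {p q} → p ∈[1, n ] → q ∈[1, n ] → p < q →
  (∀ {v₁ v₂} → v₁ ∈[1, n ] → v₂ ∈[1, n ] → v₁ < v₂ → t v₁ v₂ ≢ 0 → v₁ ≡ p × v₂ ≡ q) →
  (∑ (range1 n) λ v₁ → ∑ (range1 n) λ v₂ → ⟦ v₁ <ᵇ v₂ ⟧ * t v₁ v₂) ≡ t p q
∑-range1-single₂ n t {p} {q} p∈ q∈ p<q support = begin
  (∑ (range1 n) λ v₁ → ∑ (range1 n) λ v₂ → ⟦ v₁ <ᵇ v₂ ⟧ * t v₁ v₂)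
    ≡⟨ ∑-range1-single n _ p∈ (λ v₁∈ v₁≢p → ∑-range1-zero n _ λ v₂∈ → vanish v₁∈ v₂∈ (v₁≢p ∘′ proj₁)) ⟩
  ∑ (range1 n) (λ v₂ → ⟦ p <ᵇ v₂ ⟧ * t p v₂)
    ≡⟨ ∑-range1-single n _ q∈ (λ v₂∈ v₂≢q → vanish p∈ v₂∈ (v₂≢q ∘′ proj₂)) ⟩
  ⟦ p <ᵇ q ⟧ * t p q
    ≡⟨ cong (λ b → ⟦ b ⟧ * t p q) (dec-true (p <? q) p<q) ⟩
  1 * t p q
    ≡⟨ *-identityˡ (t p q) ⟩
  t p q ∎
  where
  open ≡-Reasoning
  vanish : ∀ {v₁ v₂} → v₁ ∈[1, n ] → v₂ ∈[1, n ] → ¬ (v₁ ≡ p × v₂ ≡ q) → ⟦ v₁ <ᵇ v₂ ⟧ * t v₁ v₂ ≡ 0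
  vanish {v₁} {v₂} v₁∈ v₂∈ off with v₁ <ᵇ v₂ in v₁<ᵇv₂
  ... | false = refl
  ... | true with t v₁ v₂ ≟ 0
  ...   | yes t≡0 = trans (+-identityʳ _) t≡0
  ...   | no t≢0  = ⊥-elim (off (support v₁∈ v₂∈ (<ᵇ⇒< v₁ v₂ (subst T (sym v₁<ᵇv₂) tt)) t≢0))

IsWord : ℕ → ℕ → List ℕ → Set
IsWord m n w = length w ≡ m × All (_∈[1, n ]) w

words-IsWord : ∀ m n → All (IsWord m n) (words m n)
words-IsWord zero    n = (refl , []) ∷ []
words-IsWord (suc m) n = AllP.concat⁺ (AllP.map⁺ (All.map extend (range1-∈ n)))
  where
  extend : ∀ {a} → a ∈[1, n ] → All (IsWord (suc m) n) (map (a ∷_) (words m n))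
  extend a∈ = AllP.map⁺ (All.map (λ (len , w∈) → cong suc len , a∈ ∷ w∈) (words-IsWord m n))

∈-words : ∀ m n {w} → IsWord m n w → w ∈ words m n
∈-words zero    n {[]}    _               = here refl
∈-words (suc m) n {a ∷ w} (len , a∈ ∷ w∈) =
  ∈-concat⁺′ (∈-map⁺ (a ∷_) (∈-words m n (suc-injective len , w∈))) (∈-map⁺ (λ a → map (a ∷_) (words m n)) (∈-range1 a∈))

∑-words-cong : ∀ m n {f g : List ℕ → ℕ} → (∀ {w} → IsWord m n w → f w ≡ g w) → ∑ (words m n) f ≡ ∑ (words m n) g
∑-words-cong m n = ∑-cong-All (words-IsWord m n)

∑-words-suc : ∀ m n (f : List ℕ → ℕ) → ∑ (words (suc m) n) f ≡ ∑ (range1 n) (λ a → ∑ (words m n) (λ w → f (a ∷ w)))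
∑-words-suc m n f = trans (∑-concatMap (range1 n) (λ a → map (a ∷_) (words m n)) f)
                          (∑-cong (range1 n) (λ a → ∑-map (words m n) (a ∷_) f))

∑-words-+ : ∀ m₁ m₂ n (f : List ℕ → ℕ) → ∑ (words (m₁ + m₂) n) f ≡ ∑ (words m₁ n) (λ u → ∑ (words m₂ n) (λ v → f (u ++ v)))
∑-words-+ zero     m₂ n f = sym (+-identityʳ _)
∑-words-+ (suc m₁) m₂ n f = trans (∑-words-suc (m₁ + m₂) n f)
  (trans (∑-cong (range1 n) (λ a → ∑-words-+ m₁ m₂ n (λ w → f (a ∷ w))))
         (sym (∑-words-suc m₁ n (λ u → ∑ (words m₂ n) (λ v → f (u ++ v))))))

∑-words-blocks : ∀ x₀ x₁ x₂ n (g : List ℕ → ℕ) →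
  ∑ (words (x₀ + suc (x₁ + suc x₂)) n) g ≡
  ∑ (words x₀ n) λ u₀ → ∑ (range1 n) λ v₁ → ∑ (words x₁ n) λ u₁ → ∑ (range1 n) λ v₂ → ∑ (words x₂ n) λ u₂ →
    g (u₀ ++ v₁ ∷ u₁ ++ v₂ ∷ u₂)
∑-words-blocks x₀ x₁ x₂ n g =
  trans (∑-words-+ x₀ (suc (x₁ + suc x₂)) n g) (∑-cong (words x₀ n) λ u₀ →
  trans (∑-words-suc (x₁ + suc x₂) n _)        (∑-cong (range1 n) λ v₁ →
  trans (∑-words-+ x₁ (suc x₂) n _)            (∑-cong (words x₁ n) λ u₁ →
  ∑-words-suc x₂ n _)))

module _ {A B : Set} (U₀ U₁ U₂ : List A) (V : List B) (k : B → B → ℕ) (h₀ h₁ h₂ : B → B → A → ℕ) where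

  ∑-interleaved-factor :
    (∑ U₀ λ u₀ → ∑ V λ v₁ → ∑ U₁ λ u₁ → ∑ V λ v₂ → ∑ U₂ λ u₂ →
       k v₁ v₂ * (h₀ v₁ v₂ u₀ * (h₁ v₁ v₂ u₁ * h₂ v₁ v₂ u₂)))
    ≡ (∑ V λ v₁ → ∑ V λ v₂ → k v₁ v₂ * (∑ U₀ (h₀ v₁ v₂) * (∑ U₁ (h₁ v₁ v₂) * ∑ U₂ (h₂ v₁ v₂))))
  ∑-interleaved-factor = begin
    (∑ U₀ λ u₀ → ∑ V λ v₁ → ∑ U₁ λ u₁ → ∑ V λ v₂ → ∑ U₂ λ u₂ →
       k v₁ v₂ * (h₀ v₁ v₂ u₀ * (h₁ v₁ v₂ u₁ * h₂ v₁ v₂ u₂)))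
      ≡⟨ ∑-cong U₀ (λ u₀ → ∑-cong V λ v₁ → ∑-cong U₁ λ u₁ → ∑-cong V λ v₂ →
           pull₃ U₂ (k v₁ v₂) (h₀ v₁ v₂ u₀) (h₁ v₁ v₂ u₁) (h₂ v₁ v₂)) ⟩
    (∑ U₀ λ u₀ → ∑ V λ v₁ → ∑ U₁ λ u₁ → ∑ V λ v₂ → k v₁ v₂ * (h₀ v₁ v₂ u₀ * (h₁ v₁ v₂ u₁ * S₂ v₁ v₂)))
      ≡⟨ ∑-cong U₀ (λ u₀ → ∑-cong V λ v₁ → ∑-comm U₁ V _) ⟩
    (∑ U₀ λ u₀ → ∑ V λ v₁ → ∑ V λ v₂ → ∑ U₁ λ u₁ → k v₁ v₂ * (h₀ v₁ v₂ u₀ * (h₁ v₁ v₂ u₁ * S₂ v₁ v₂)))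
      ≡⟨ ∑-cong U₀ (λ u₀ → ∑-cong V λ v₁ → ∑-cong V λ v₂ →
           pull₂ U₁ (k v₁ v₂) (h₀ v₁ v₂ u₀) (S₂ v₁ v₂) (h₁ v₁ v₂)) ⟩
    (∑ U₀ λ u₀ → ∑ V λ v₁ → ∑ V λ v₂ → k v₁ v₂ * (h₀ v₁ v₂ u₀ * (S₁ v₁ v₂ * S₂ v₁ v₂)))
      ≡⟨ trans (∑-comm U₀ V _) (∑-cong V λ v₁ → ∑-comm U₀ V _) ⟩
    (∑ V λ v₁ → ∑ V λ v₂ → ∑ U₀ λ u₀ → k v₁ v₂ * (h₀ v₁ v₂ u₀ * (S₁ v₁ v₂ * S₂ v₁ v₂)))
      ≡⟨ ∑-cong V (λ v₁ → ∑-cong V λ v₂ → pull₁ U₀ (k v₁ v₂) (S₁ v₁ v₂ * S₂ v₁ v₂) (h₀ v₁ v₂)) ⟩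
    (∑ V λ v₁ → ∑ V λ v₂ → k v₁ v₂ * (∑ U₀ (h₀ v₁ v₂) * (S₁ v₁ v₂ * S₂ v₁ v₂))) ∎
    where
    open ≡-Reasoning
    S₁ S₂ : B → B → ℕ
    S₁ v₁ v₂ = ∑ U₁ (h₁ v₁ v₂)
    S₂ v₁ v₂ = ∑ U₂ (h₂ v₁ v₂)
    pull₃ : ∀ xs a b d (f : A → ℕ) → ∑ xs (λ x → a * (b * (d * f x))) ≡ a * (b * (d * ∑ xs f))
    pull₃ xs a b d f = trans (∑-*ˡ xs a _) (cong (a *_) (trans (∑-*ˡ xs b _) (cong (b *_) (∑-*ˡ xs d f))))
    pull₂ : ∀ xs a b e (f : A → ℕ) → ∑ xs (λ x → a * (b * (f x * e))) ≡ a * (b * (∑ xs f * e))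
    pull₂ xs a b e f = trans (∑-*ˡ xs a _) (cong (a *_) (trans (∑-*ˡ xs b _) (cong (b *_) (∑-*ʳ xs e f))))
    pull₁ : ∀ xs a e (f : A → ℕ) → ∑ xs (λ x → a * (f x * e)) ≡ a * (∑ xs f * e)
    pull₁ xs a e f = trans (∑-*ˡ xs a _) (cong (a *_) (∑-*ʳ xs e f))

-- Counting injective words

falling : ℕ → ℕ → ℕ
falling k zero    = 1
falling k (suc m) = k * falling (k ∸ 1) m

falling-self : ∀ k → falling k k ≡ k !
falling-self zero    = refl
falling-self (suc k) = cong (suc k *_) (falling-self k)

falling-0 : ∀ {x} → x ≢ 0 → falling 0 x ≡ 0
falling-0 {zero}  x≢0 = ⊥-elim (x≢0 refl)
falling-0 {suc x} _   = refl

falling-0-∸ : ∀ {j k} → k < j → falling 0 (j ∸ k) ≡ 0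
falling-0-∸ k<j = falling-0 (m>n⇒m∸n≢0 k<j)

falling≢0⇒≤ : ∀ y x → falling y x ≢ 0 → x ≤ y
falling≢0⇒≤ y       zero    _  = z≤n
falling≢0⇒≤ zero    (suc x) nz = ⊥-elim (nz refl)
falling≢0⇒≤ (suc y) (suc x) nz = s≤s (falling≢0⇒≤ y x λ eq → nz (trans (cong (suc y *_) eq) (*-zeroʳ (suc y))))

falling-< : ∀ {k m} → k < m → falling k m ≡ 0
falling-< {zero}  {suc m} _         = refl
falling-< {suc k} {suc m} (s≤s k<m) = trans (cong (suc k *_) (falling-< k<m)) (*-zeroʳ (suc k))

count : ℕ → (ℕ → Bool) → ℕ
count n Q = ∑ (range1 n) (λ x → ⟦ Q x ⟧)

count-suc : ∀ n (Q : ℕ → Bool) → count (suc n) Q ≡ count n Q + ⟦ Q (suc n) ⟧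
count-suc n Q = ∑-range1-suc n (λ x → ⟦ Q x ⟧)

count-true : ∀ n → count n (λ _ → true) ≡ n
count-true zero    = refl
count-true (suc n) = trans (count-suc n _) (trans (cong (_+ 1) (count-true n)) (+-comm n 1))

count-remove : ∀ n (Q : ℕ → Bool) {a} → a ∈[1, n ] → count n (λ x → Q x ∧ not (a ≡ᵇ x)) + ⟦ Q a ⟧ ≡ count n Q
count-remove n Q {a} a∈ = begin
  count n (λ x → Q x ∧ not (a ≡ᵇ x)) + ⟦ Q a ⟧
    ≡⟨ cong (count n (λ x → Q x ∧ not (a ≡ᵇ x)) +_) (sym only-a) ⟩
  count n (λ x → Q x ∧ not (a ≡ᵇ x)) + count n (λ x → Q x ∧ (a ≡ᵇ x))
    ≡⟨ sym (∑-+ (range1 n) _ _) ⟩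
  ∑ (range1 n) (λ x → ⟦ Q x ∧ not (a ≡ᵇ x) ⟧ + ⟦ Q x ∧ (a ≡ᵇ x) ⟧)
    ≡⟨ ∑-cong (range1 n) (λ x → split (Q x) (a ≡ᵇ x)) ⟩
  count n Q ∎
  where
  open ≡-Reasoning
  split : ∀ q e → ⟦ q ∧ not e ⟧ + ⟦ q ∧ e ⟧ ≡ ⟦ q ⟧
  split true  true  = refl
  split true  false = refl
  split false e     = refl
  only-a : count n (λ x → Q x ∧ (a ≡ᵇ x)) ≡ ⟦ Q a ⟧
  only-a = trans
    (∑-range1-single n _ a∈ λ {x} _ x≢a → trans (cong (λ e → ⟦ Q x ∧ e ⟧) (dec-false (a ≟ x) (x≢a ∘′ sym))) (cong ⟦_⟧ (∧-zeroʳ (Q x))))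
    (trans (cong (λ e → ⟦ Q a ∧ e ⟧) (dec-true (a ≟ a) refl)) (cong ⟦_⟧ (∧-identityʳ (Q a))))

∑-words-injective : ∀ m n (Q : ℕ → Bool) → ∑ (words m n) (λ w → ⟦ distinct w ∧ all Q w ⟧) ≡ falling (count n Q) m
∑-words-injective zero    n Q = refl
∑-words-injective (suc m) n Q = begin
  ∑ (words (suc m) n) (λ w → ⟦ distinct w ∧ all Q w ⟧)
    ≡⟨ ∑-words-suc m n _ ⟩
  ∑ (range1 n) (λ a → ∑ (words m n) (λ w → ⟦ (not (any (a ≡ᵇ_) w) ∧ distinct w) ∧ (Q a ∧ all Q w) ⟧))
    ≡⟨ ∑-cong (range1 n) (λ a → ∑-cong (words m n) (λ w → trans (cong ⟦_⟧ (peel a w)) (⟦∧⟧ (Q a) _))) ⟩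
  ∑ (range1 n) (λ a → ∑ (words m n) (λ w → ⟦ Q a ⟧ * ⟦ distinct w ∧ all (Q≢ a) w ⟧))
    ≡⟨ ∑-cong (range1 n) (λ a → ∑-*ˡ (words m n) ⟦ Q a ⟧ _) ⟩
  ∑ (range1 n) (λ a → ⟦ Q a ⟧ * ∑ (words m n) (λ w → ⟦ distinct w ∧ all (Q≢ a) w ⟧))
    ≡⟨ ∑-cong (range1 n) (λ a → cong (⟦ Q a ⟧ *_) (∑-words-injective m n (Q≢ a))) ⟩
  ∑ (range1 n) (λ a → ⟦ Q a ⟧ * falling (count n (Q≢ a)) m)
    ≡⟨ ∑-range1-cong n (λ a∈ → one-fewer a∈) ⟩
  ∑ (range1 n) (λ a → ⟦ Q a ⟧ * falling (count n Q ∸ 1) m)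
    ≡⟨ ∑-*ʳ (range1 n) _ (λ a → ⟦ Q a ⟧) ⟩
  count n Q * falling (count n Q ∸ 1) m ∎
  where
  open ≡-Reasoning
  Q≢ : ℕ → ℕ → Bool
  Q≢ a x = Q x ∧ not (a ≡ᵇ x)
  peel : ∀ a w → (not (any (a ≡ᵇ_) w) ∧ distinct w) ∧ (Q a ∧ all Q w) ≡ Q a ∧ (distinct w ∧ all (Q≢ a) w)
  peel a w rewrite all-∧ Q (λ x → not (a ≡ᵇ x)) w | sym (not-any (a ≡ᵇ_) w) =
    solve 4 (λ na d q aq → (na :* d) :* (q :* aq) := q :* (d :* (aq :* na))) refl (not (any (a ≡ᵇ_) w)) (distinct w) (Q a) (all Q w)
    where
    open import Data.Bool.Solver using (module ∨-∧-Solver)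
    open ∨-∧-Solver
  one-fewer : ∀ {a} → a ∈[1, n ] → ⟦ Q a ⟧ * falling (count n (Q≢ a)) m ≡ ⟦ Q a ⟧ * falling (count n Q ∸ 1) m
  one-fewer {a} a∈ with Q a | count-remove n Q a∈
  ... | true  | eq = cong (λ k → falling k m + 0) (sym (trans (cong (_∸ 1) (sym eq)) (m+n∸n≡m _ 1)))
  ... | false | _  = refl

count-above : ∀ n lo → count n (lo <ᵇ_) ≡ n ∸ lo
count-above zero    lo = sym (0∸n≡0 lo)
count-above (suc n) lo with lo ≤? n
... | yes lo≤n = begin
  count (suc n) (lo <ᵇ_)             ≡⟨ count-suc n _ ⟩
  count n (lo <ᵇ_) + ⟦ lo <ᵇ suc n ⟧ ≡⟨ cong₂ _+_ (count-above n lo) (cong ⟦_⟧ (dec-true (lo <? suc n) (s≤s lo≤n))) ⟩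
  n ∸ lo + 1                         ≡⟨ +-comm (n ∸ lo) 1 ⟩
  suc (n ∸ lo)                       ≡⟨ +-∸-assoc 1 lo≤n ⟨
  suc n ∸ lo                         ∎
  where
  open ≡-Reasoning
... | no lo≰n = begin
  count (suc n) (lo <ᵇ_)             ≡⟨ count-suc n _ ⟩
  count n (lo <ᵇ_) + ⟦ lo <ᵇ suc n ⟧ ≡⟨ cong₂ _+_ (count-above n lo) (cong ⟦_⟧ (dec-false (lo <? suc n) (lo≰n ∘′ ≤-pred))) ⟩
  n ∸ lo + 0                         ≡⟨ cong (_+ 0) (m≤n⇒m∸n≡0 (<⇒≤ (≰⇒> lo≰n))) ⟩
  0                                  ≡⟨ m≤n⇒m∸n≡0 (≰⇒> lo≰n) ⟨
  suc n ∸ lo                         ∎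
  where
  open ≡-Reasoning

count-interval : ∀ n lo hi → hi ≤ suc n → count n (λ x → lo <ᵇ x <ᵇ hi) ≡ hi ∸ 1 ∸ lo
count-interval zero    lo hi hi≤1 = sym (trans (cong (_∸ lo) (m≤n⇒m∸n≡0 hi≤1)) (0∸n≡0 lo))
count-interval (suc n) lo hi hi≤n+2 with m≤n⇒m<n∨m≡n hi≤n+2
... | inj₁ hi≤n+1 = begin
  count (suc n) (λ x → lo <ᵇ x <ᵇ hi)
    ≡⟨ count-suc n _ ⟩
  count n (λ x → lo <ᵇ x <ᵇ hi) + ⟦ lo <ᵇ suc n <ᵇ hi ⟧
    ≡⟨ cong₂ _+_ (count-interval n lo hi (≤-pred hi≤n+1)) (cong (λ b → ⟦ (lo <ᵇ suc n) ∧ b ⟧) (dec-false (suc n <? hi) (≤⇒≯ (≤-pred hi≤n+1)))) ⟩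
  hi ∸ 1 ∸ lo + ⟦ (lo <ᵇ suc n) ∧ false ⟧
    ≡⟨ cong (λ b → hi ∸ 1 ∸ lo + ⟦ b ⟧) (∧-zeroʳ (lo <ᵇ suc n)) ⟩
  hi ∸ 1 ∸ lo + 0
    ≡⟨ +-identityʳ _ ⟩
  hi ∸ 1 ∸ lo ∎
  where
  open ≡-Reasoning
... | inj₂ refl = trans (∑-range1-cong (suc n) below-hi) (count-above (suc n) lo)
  where
  below-hi : ∀ {x} → x ∈[1, suc n ] → ⟦ lo <ᵇ x <ᵇ suc (suc n) ⟧ ≡ ⟦ lo <ᵇ x ⟧
  below-hi {x} (_ , x≤n+1) =
    trans (cong (λ b → ⟦ (lo <ᵇ x) ∧ b ⟧) (dec-true (x <? suc (suc n)) (s≤s x≤n+1))) (cong ⟦_⟧ (∧-identityʳ (lo <ᵇ x)))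

perms-IsWord : ∀ n → All (IsWord n n) (perms n)
perms-IsWord n = AllP.filter⁺ (λ w → T? (distinct w)) (words-IsWord n n)

perms-Unique : ∀ n → All Unique (perms n)
perms-Unique n = All.map (distinct⇒Unique _) (AllP.all-filter (λ w → T? (distinct w)) (words n n))

∑-perms : ∀ n (f : List ℕ → ℕ) → ∑ (perms n) f ≡ ∑ (words n n) (λ w → ⟦ distinct w ⟧ * f w)
∑-perms n f = ∑-filter (words n n) distinct f

length-perms : ∀ n → length (perms n) ≡ n !
length-perms n = begin
  length (perms n)                                           ≡⟨ length-filter (words n n) distinct ⟩
  ∑ (words n n) (λ w → ⟦ distinct w ⟧)
    ≡⟨ ∑-cong (words n n) (λ w → cong ⟦_⟧ (sym (trans (cong (distinct w ∧_) (all-true w)) (∧-identityʳ (distinct w))))) ⟩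
  ∑ (words n n) (λ w → ⟦ distinct w ∧ all (λ _ → true) w ⟧)   ≡⟨ ∑-words-injective n n (λ _ → true) ⟩
  falling (count n (λ _ → true)) n                           ≡⟨ cong (λ k → falling k n) (count-true n) ⟩
  falling n n                                                ≡⟨ falling-self n ⟩
  n !                                                        ∎
  where
  open ≡-Reasoning
  all-true : ∀ (w : List ℕ) → all (λ _ → true) w ≡ true
  all-true []      = refl
  all-true (_ ∷ w) = all-true w

-- If y were missing, w would be one of the falling (n ∸ 1) n = 0 injective words of length n avoiding y.
perm-surjective : ∀ {n w} → IsWord n n w → Unique w → ∀ {y} → y ∈[1, n ] → y ∈ w
perm-surjective {n} {w} isWord unique {y} y∈ with any? (y ≟_) w
... | yes y∈w = y∈w
... | no  y∉w = ⊥-elim (<⇒≱ (s≤s z≤n) (begin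
  1                                                ≡⟨ cong ⟦_⟧ (Equivalence.to T-≡ avoiding) ⟨
  ⟦ distinct w ∧ all Q w ⟧                          ≤⟨ ∑-≥ (λ u → ⟦ distinct u ∧ all Q u ⟧) (∈-words n n isWord) ⟩
  ∑ (words n n) (λ u → ⟦ distinct u ∧ all Q u ⟧)    ≡⟨ ∑-words-injective n n Q ⟩
  falling (count n Q) n                            ≡⟨ cong (λ k → falling k n) count-Q ⟩
  falling (n ∸ 1) n                                ≡⟨ falling-< (≤-reflexive (m+[n∸m]≡n (≤-trans (proj₁ y∈) (proj₂ y∈)))) ⟩
  0                                                ∎))
  where
  open ≤-Reasoning
  Q : ℕ → Bool
  Q x = not (y ≡ᵇ x)
  avoiding : T (distinct w ∧ all Q w)
  avoiding = Equivalence.from T-∧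
    (Unique⇒distinct unique , all⁻ Q (All.map (λ y≢x → Equivalence.from T-not (y≢x ∘′ ≡ᵇ⇒≡ y _)) (¬Any⇒All¬ w y∉w)))
  count-Q : count n Q ≡ n ∸ 1
  count-Q = trans (sym (m+n∸n≡m (count n Q) 1)) (cong (_∸ 1) (trans (count-remove n (λ _ → true) y∈) (count-true n)))

at-∈ : ∀ w {k} → k ∈[1, length w ] → at w k ∈ w
at-∈ (x ∷ w)     {suc zero}    _              = here refl
at-∈ (x ∷ w)     {suc (suc k)} (_ , s≤s k<l) = there (at-∈ w (s≤s z≤n , k<l))

at-injective : ∀ {w} → Unique w → ∀ {k k′} → k ∈[1, length w ] → k′ ∈[1, length w ] → at w k ≡ at w k′ → k ≡ k′
at-injective {x ∷ w} (x∉ ∷ _) {suc zero}    {suc zero}     _ _ _ = refl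
at-injective {x ∷ w} (x∉ ∷ _) {suc zero}    {suc (suc k′)} _ (_ , s≤s k′<l) x≡ = ⊥-elim (All.lookup x∉ (at-∈ w (s≤s z≤n , k′<l)) x≡)
at-injective {x ∷ w} (x∉ ∷ _) {suc (suc k)} {suc zero}     (_ , s≤s k<l) _ ≡x = ⊥-elim (All.lookup x∉ (at-∈ w (s≤s z≤n , k<l)) (sym ≡x))
at-injective {x ∷ w} (_ ∷ u)  {suc (suc k)} {suc (suc k′)} (_ , s≤s k<l) (_ , s≤s k′<l) eq =
  cong suc (at-injective u (s≤s z≤n , k<l) (s≤s z≤n , k′<l) eq)

split-at : ∀ (w : List ℕ) k → k < length w → ∃[ u ] ∃[ v ] ∃[ u′ ] w ≡ u ++ v ∷ u′ × length u ≡ k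
split-at (x ∷ w) zero    _         = [] , x , w , refl , refl
split-at (x ∷ w) (suc k) (s≤s k<l) with split-at w k k<l
... | u , v , u′ , refl , refl = x ∷ u , v , u′ , refl , refl

-- Zero-one statistics

distribution01 : ℕ → ℕ → ℕ → ℕ
distribution01 N S zero          = N ∸ S
distribution01 N S (suc zero)    = S
distribution01 N S (suc (suc _)) = 0

module _ {A : Set} (f : A → ℕ) {xs : List A} (f≤1 : All (λ x → f x ≤ 1) xs) where

  private
    pointwise : {g h : A → ℕ} → (∀ {m} → m ≤ 1 → ∀ {x} → f x ≡ m → g x ≡ h x) → ∑ xs g ≡ ∑ xs h
    pointwise eq = ∑-cong-All f≤1 (λ {x} fx≤1 → eq fx≤1 refl)

    zeros+ones : ∑ xs (λ x → ⟦ f x ≡ᵇ 0 ⟧) + ∑ xs f ≡ length xs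
    zeros+ones = trans (sym (∑-+ xs _ f)) (trans (pointwise one) (∑-one xs))
      where
      one : ∀ {m} → m ≤ 1 → ∀ {x} → f x ≡ m → ⟦ f x ≡ᵇ 0 ⟧ + f x ≡ 1
      one z≤n       eq rewrite eq = refl
      one (s≤s z≤n) eq rewrite eq = refl
      ∑-one : ∀ ys → ∑ ys (λ _ → 1) ≡ length ys
      ∑-one []       = refl
      ∑-one (y ∷ ys) = cong suc (∑-one ys)

  ∑-zeros : ∑ xs (λ x → ⟦ f x ≡ᵇ 0 ⟧) ≡ length xs ∸ ∑ xs f
  ∑-zeros = trans (sym (m+n∸n≡m _ (∑ xs f))) (cong (_∸ ∑ xs f) zeros+ones)

  ∑-^-01 : ∀ q → ∑ xs (λ x → q ^ f x) ≡ (length xs ∸ ∑ xs f) + q * ∑ xs f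
  ∑-^-01 q = begin
    ∑ xs (λ x → q ^ f x)                                ≡⟨ pointwise split ⟩
    ∑ xs (λ x → ⟦ f x ≡ᵇ 0 ⟧ + q * f x)                 ≡⟨ ∑-+ xs _ _ ⟩
    ∑ xs (λ x → ⟦ f x ≡ᵇ 0 ⟧) + ∑ xs (λ x → q * f x)    ≡⟨ cong₂ _+_ ∑-zeros (∑-*ˡ xs q f) ⟩
    (length xs ∸ ∑ xs f) + q * ∑ xs f                   ∎
    where
    open ≡-Reasoning
    split : ∀ {m} → m ≤ 1 → ∀ {x} → f x ≡ m → q ^ f x ≡ ⟦ f x ≡ᵇ 0 ⟧ + q * f x
    split z≤n       eq rewrite eq = cong suc (sym (*-zeroʳ q))
    split (s≤s z≤n) eq rewrite eq = refl

  count-01 : ∀ k → length (filter (λ x → T? (f x ≡ᵇ k)) xs) ≡ distribution01 (length xs) (∑ xs f) k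
  count-01 k = trans (length-filter xs (λ x → f x ≡ᵇ k)) (by-value k)
    where
    by-value : ∀ k → ∑ xs (λ x → ⟦ f x ≡ᵇ k ⟧) ≡ distribution01 (length xs) (∑ xs f) k
    by-value zero          = ∑-zeros
    by-value (suc zero)    = pointwise λ
      { z≤n       eq → trans (cong (λ m → ⟦ m ≡ᵇ 1 ⟧) eq) (sym eq)
      ; (s≤s z≤n) eq → trans (cong (λ m → ⟦ m ≡ᵇ 1 ⟧) eq) (sym eq) }
    by-value (suc (suc k)) = trans (pointwise λ
      { z≤n       eq → cong (λ m → ⟦ m ≡ᵇ suc (suc k) ⟧) eq
      ; (s≤s z≤n) eq → cong (λ m → ⟦ m ≡ᵇ suc (suc k) ⟧) eq }) (∑-zero xs)

occurrencesAt : MeshR → ℕ → ℕ → ℕ → ℕ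
occurrencesAt R n i j = ∑ (perms n) (λ π → ⟦ isOcc R π i j ⟧)

occ≡∑ : ∀ R π → occ R π ≡ ∑ (range1 (length π)) λ i → ∑ (range1 (length π)) λ j → ⟦ isOcc R π i j ⟧
occ≡∑ R π = begin
  occ R π
    ≡⟨ length-filter (concatMap (λ i → map (i ,_) V) V) (λ (i , j) → isOcc R π i j) ⟩
  ∑ (concatMap (λ i → map (i ,_) V) V) (λ (i , j) → ⟦ isOcc R π i j ⟧)
    ≡⟨ ∑-concatMap V (λ i → map (i ,_) V) _ ⟩
  ∑ V (λ i → ∑ (map (i ,_) V) (λ (i , j) → ⟦ isOcc R π i j ⟧))
    ≡⟨ ∑-cong V (λ i → ∑-map V (i ,_) _) ⟩
  ∑ V (λ i → ∑ V λ j → ⟦ isOcc R π i j ⟧) ∎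
  where
  open ≡-Reasoning
  V : List ℕ
  V = range1 (length π)

occ≤1 : ∀ R π → (∀ {i j i′ j′} → i ∈[1, length π ] → j ∈[1, length π ] → i′ ∈[1, length π ] → j′ ∈[1, length π ] →
                   T (isOcc R π i j) → T (isOcc R π i′ j′) → i ≡ i′ × j ≡ j′) → occ R π ≤ 1
occ≤1 R π same = length≤1
  (Unique.filter⁺ isOcc? (subst Unique (sym (pairs≡cartesianProduct V V)) (Unique.cartesianProduct⁺ (Unique-range1 n) (Unique-range1 n))))
  λ {(i , j)} {(i′ , j′)} ij∈ ij′∈ →
    let (ij∈V² , occ-ij) = ∈-filter⁻ isOcc? ij∈ ; (ij′∈V² , occ-ij′) = ∈-filter⁻ isOcc? ij′∈
        (i∈ , j∈) = bounds ij∈V² ; (i′∈ , j′∈) = bounds ij′∈V²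
        (i≡i′ , j≡j′) = same i∈ j∈ i′∈ j′∈ occ-ij occ-ij′
    in cong₂ _,_ i≡i′ j≡j′
  where
  n : ℕ
  n = length π
  V : List ℕ
  V = range1 n
  isOcc? : (ij : ℕ × ℕ) → Dec (T (isOcc R π (proj₁ ij) (proj₂ ij)))
  isOcc? (i , j) = T? (isOcc R π i j)
  bounds : ∀ {i j} → (i , j) ∈ concatMap (λ i → map (i ,_) V) V → i ∈[1, n ] × j ∈[1, n ]
  bounds ij∈ = let (i∈V , j∈V) = ∈-cartesianProduct⁻ V V (subst ((_ , _) ∈_) (pairs≡cartesianProduct V V) ij∈)
               in All.lookup (range1-∈ n) i∈V , All.lookup (range1-∈ n) j∈V

anyIndexed : (ℕ → Bool) → (ℕ → Bool) → ℕ → List ℕ → Bool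
anyIndexed C G o []       = false
anyIndexed C G o (y ∷ ys) = (C (suc o) ∧ G y) ∨ anyIndexed C G (suc o) ys

any-at≡anyIndexed : ∀ (C G : ℕ → Bool) o π → any (λ k → C (o + k) ∧ G (at π k)) (range1 (length π)) ≡ anyIndexed C G o π
any-at≡anyIndexed C G o []       = refl
any-at≡anyIndexed C G o (x ∷ xs) = cong₂ _∨_ (cong (λ k → C k ∧ G x) (+-comm o 1)) (begin
  any P (map suc (applyUpTo suc m))                                 ≡⟨ any-map P suc (applyUpTo suc m) ⟩
  any (P ∘′ suc) (applyUpTo suc m)                                  ≡⟨ cong (any (P ∘′ suc)) (map-upTo suc m) ⟨
  any (P ∘′ suc) (map suc (upTo m))                                 ≡⟨ any-map (P ∘′ suc) suc (upTo m) ⟩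
  any (λ k → C (o + suc (suc k)) ∧ G (at xs (suc k))) (upTo m)     ≡⟨ any-cong (upTo m) (λ k → cong (λ o' → C o' ∧ G (at xs (suc k))) (+-suc o (suc k))) ⟩
  any (λ k → C (suc o + suc k) ∧ G (at xs (suc k))) (upTo m)       ≡⟨ any-map _ suc (upTo m) ⟨
  any (λ k → C (suc o + k) ∧ G (at xs k)) (range1 m)               ≡⟨ any-at≡anyIndexed C G (suc o) xs ⟩
  anyIndexed C G (suc o) xs                                         ∎)
  where
  open ≡-Reasoning
  m : ℕ
  m = length xs
  P : ℕ → Bool
  P k = C (o + k) ∧ G (at (x ∷ xs) k)

anyIndexed-++ : ∀ C G o xs ys → anyIndexed C G o (xs ++ ys) ≡ anyIndexed C G o xs ∨ anyIndexed C G (o + length xs) ys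
anyIndexed-++ C G o []       ys = cong (λ o' → anyIndexed C G o' ys) (sym (+-identityʳ o))
anyIndexed-++ C G o (x ∷ xs) ys = begin
  (C (suc o) ∧ G x) ∨ anyIndexed C G (suc o) (xs ++ ys)
    ≡⟨ cong ((C (suc o) ∧ G x) ∨_) (anyIndexed-++ C G (suc o) xs ys) ⟩
  (C (suc o) ∧ G x) ∨ (anyIndexed C G (suc o) xs ∨ anyIndexed C G (suc o + length xs) ys)
    ≡⟨ sym (∨-assoc (C (suc o) ∧ G x) _ _) ⟩
  ((C (suc o) ∧ G x) ∨ anyIndexed C G (suc o) xs) ∨ anyIndexed C G (suc o + length xs) ys
    ≡⟨ cong (λ o' → ((C (suc o) ∧ G x) ∨ anyIndexed C G (suc o) xs) ∨ anyIndexed C G o' ys) (sym (+-suc o (length xs))) ⟩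
  ((C (suc o) ∧ G x) ∨ anyIndexed C G (suc o) xs) ∨ anyIndexed C G (o + suc (length xs)) ys ∎
  where
  open ≡-Reasoning

anyIndexed-inside : ∀ {lo hi} G o xs → lo ≤ o → o + length xs < hi → anyIndexed (λ k → lo <ᵇ k <ᵇ hi) G o xs ≡ any G xs
anyIndexed-inside G o []       lo≤o _    = refl
anyIndexed-inside {lo} {hi} G o (x ∷ xs) lo≤o o+l<hi = cong₂ (λ b rest → (b ∧ G x) ∨ rest)
  (cong₂ _∧_ (dec-true (lo <? suc o) (s≤s lo≤o)) (dec-true (suc o <? hi) (≤-<-trans (s≤s (m≤m+n o (length xs))) o+sl<hi)))
  (anyIndexed-inside G (suc o) xs (m≤n⇒m≤1+n lo≤o) o+sl<hi)
  where
  o+sl<hi : suc o + length xs < hi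
  o+sl<hi = subst (_< hi) (+-suc o (length xs)) o+l<hi

anyIndexed-outside : ∀ {lo hi} G o xs → o + length xs ≤ lo ⊎ hi ≤ suc o → anyIndexed (λ k → lo <ᵇ k <ᵇ hi) G o xs ≡ false
anyIndexed-outside G o []       _ = refl
anyIndexed-outside {lo} {hi} G o (x ∷ xs) (inj₁ o+l≤lo)
  rewrite dec-false (lo <? suc o) (≤⇒≯ (≤-trans (s≤s (m≤m+n o (length xs))) (subst (_≤ lo) (+-suc o (length xs)) o+l≤lo)))
  = anyIndexed-outside {lo} {hi} G (suc o) xs (inj₁ (subst (_≤ lo) (+-suc o (length xs)) o+l≤lo))
anyIndexed-outside {lo} {hi} G o (x ∷ xs) (inj₂ hi≤o+1) rewrite dec-false (suc o <? hi) (≤⇒≯ hi≤o+1) | ∧-zeroʳ (lo <ᵇ suc o)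
  = anyIndexed-outside {lo} {hi} G (suc o) xs (inj₂ (m≤n⇒m≤1+n hi≤o+1))

at-++-∷ : ∀ xs y ys → at (xs ++ y ∷ ys) (suc (length xs)) ≡ y
at-++-∷ []           y ys = refl
at-++-∷ (x ∷ [])     y ys = refl
at-++-∷ (x ∷ x′ ∷ xs) y ys = at-++-∷ (x′ ∷ xs) y ys

at-++ : ∀ xs ys k → at (xs ++ ys) (length xs + suc k) ≡ at ys (suc k)
at-++ []       ys k = refl
at-++ (x ∷ xs) ys k = begin
  at (x ∷ xs ++ ys) (suc (length xs + suc k)) ≡⟨ cong (at (x ∷ xs ++ ys) ∘′ suc) (+-suc (length xs) k) ⟩
  at (xs ++ ys) (suc (length xs + k))         ≡⟨ cong (at (xs ++ ys)) (+-suc (length xs) k) ⟨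
  at (xs ++ ys) (length xs + suc k)           ≡⟨ at-++ xs ys k ⟩
  at ys (suc k)                               ∎
  where
  open ≡-Reasoning

outside-interval : ∀ {lo k hi} → k ≤ lo ⊎ hi ≤ k → (lo <ᵇ k <ᵇ hi) ≡ false
outside-interval {lo} {k} {hi} (inj₁ k≤lo) = cong (_∧ (k <ᵇ hi)) (dec-false (lo <? k) (≤⇒≯ k≤lo))
outside-interval {lo} {k} {hi} (inj₂ hi≤k) = trans (cong ((lo <ᵇ k) ∧_) (dec-false (k <? hi) (≤⇒≯ hi≤k))) (∧-zeroʳ (lo <ᵇ k))

inRow : ℕ → ℕ → ℕ → Fin 3 → ℕ → Bool
inRow n v₁ v₂ b y = proj₁ (bnd n v₁ v₂ b) <ᵇ y <ᵇ proj₂ (bnd n v₁ v₂ b)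

inRowᵐ : ℕ → ℕ → ℕ → Maybe (Fin 3) → ℕ → Bool
inRowᵐ n v₁ v₂ nothing  y = false
inRowᵐ n v₁ v₂ (just b) y = inRow n v₁ v₂ b y

pick : {A : Set} → Fin 3 → A → A → A → A
pick zero             x y z = x
pick (suc zero)       x y z = y
pick (suc (suc zero)) x y z = z

-- The strip (0 , u), (u , v) or (v , n + 1) of [1, n] cut at u < v contains no integer.
EmptyStrip : Fin 3 → ℕ → ℕ → ℕ → Set
EmptyStrip zero             n u v = u ≡ 1
EmptyStrip (suc zero)       n u v = v ≡ suc u
EmptyStrip (suc (suc zero)) n u v = v ≡ n

+-suc-suc : ∀ a b c → a + suc (b + suc c) ≡ suc (suc (a + (b + c)))
+-suc-suc a b c = solve 3 (λ a b c → a :+ (con 1 :+ (b :+ (con 1 :+ c))) := con 2 :+ (a :+ (b :+ c))) refl a b c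
  where
  open import Data.Nat.Solver using (module +-*-Solver)
  open +-*-Solver

-- The word cut at the positions i and j of v₁ and v₂; block a is its part in column a of the mesh diagram.
module Blocks (u₀ : List ℕ) (v₁ : ℕ) (u₁ : List ℕ) (v₂ : ℕ) (u₂ : List ℕ) where

  word : List ℕ
  word = u₀ ++ v₁ ∷ u₁ ++ v₂ ∷ u₂

  block : Fin 3 → List ℕ
  block a = pick a u₀ u₁ u₂

  l₀ l₁ l₂ i j n : ℕ
  l₀ = length u₀
  l₁ = length u₁
  l₂ = length u₂
  i = suc l₀
  j = suc (suc (l₀ + l₁))
  n = length word

  length-word : n ≡ l₀ + suc (l₁ + suc l₂)
  length-word = trans (length-++ u₀) (cong (λ m → l₀ + suc m) (length-++ u₁))

  j+l₂≡n : j + l₂ ≡ n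
  j+l₂≡n = sym (trans length-word (trans (+-suc-suc l₀ l₁ l₂) (cong (suc ∘′ suc) (sym (+-assoc l₀ l₁ l₂)))))

  at-i : at word i ≡ v₁
  at-i = at-++-∷ u₀ v₁ (u₁ ++ v₂ ∷ u₂)

  at-j : at word j ≡ v₂
  at-j = begin
    at word (suc (suc (l₀ + l₁)))   ≡⟨ cong (at word) (trans (cong suc (sym (+-suc l₀ l₁))) (sym (+-suc l₀ (suc l₁)))) ⟩
    at word (l₀ + suc (suc l₁))     ≡⟨ at-++ u₀ (v₁ ∷ u₁ ++ v₂ ∷ u₂) (suc l₁) ⟩
    at (u₁ ++ v₂ ∷ u₂) (suc l₁)     ≡⟨ at-++-∷ u₁ v₂ u₂ ⟩
    v₂                              ∎
    where
    open ≡-Reasoning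

  i<j : i < j
  i<j = s≤s (s≤s (m≤m+n l₀ l₁))

  anyIndexed-word : ∀ C G → C i ≡ false → C j ≡ false →
    anyIndexed C G 0 word ≡ anyIndexed C G 0 u₀ ∨ (anyIndexed C G i u₁ ∨ anyIndexed C G j u₂)
  anyIndexed-word C G Ci Cj
    rewrite anyIndexed-++ C G 0 u₀ (v₁ ∷ u₁ ++ v₂ ∷ u₂) | anyIndexed-++ C G i u₁ (v₂ ∷ u₂) | Ci | Cj = refl

  lo hi : Fin 3 → ℕ
  lo a = proj₁ (bnd n i j a)
  hi a = proj₂ (bnd n i j a)

  column : Fin 3 → ℕ → Bool
  column a k = lo a <ᵇ k <ᵇ hi a

  column-outside : ∀ a k → k ≤ lo a ⊎ hi a ≤ k → column a k ≡ false
  column-outside a k = outside-interval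

  inside : ∀ a G o xs → lo a ≤ o → o + length xs < hi a → anyIndexed (column a) G o xs ≡ any G xs
  inside a = anyIndexed-inside

  outside : ∀ a G o xs → o + length xs ≤ lo a ⊎ hi a ≤ suc o → anyIndexed (column a) G o xs ≡ false
  outside a = anyIndexed-outside

  anyIndexed-column : ∀ a G → anyIndexed (column a) G 0 word ≡ any G (block a)
  anyIndexed-column zero G = begin
    anyIndexed (column zero) G 0 word
      ≡⟨ anyIndexed-word (column zero) G (column-outside zero i (inj₂ ≤-refl)) (column-outside zero j (inj₂ (<⇒≤ i<j))) ⟩
    anyIndexed (column zero) G 0 u₀ ∨ (anyIndexed (column zero) G i u₁ ∨ anyIndexed (column zero) G j u₂)
      ≡⟨ cong₂ _∨_ (inside zero G 0 u₀ z≤n ≤-refl)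
                   (cong₂ _∨_ (outside zero G i u₁ (inj₂ (n≤1+n i))) (outside zero G j u₂ (inj₂ (<⇒≤ (m<n⇒m<1+n i<j))))) ⟩
    any G u₀ ∨ false
      ≡⟨ ∨-identityʳ (any G u₀) ⟩
    any G u₀ ∎
    where
    open ≡-Reasoning
  anyIndexed-column (suc zero) G = begin
    anyIndexed (column (suc zero)) G 0 word
      ≡⟨ anyIndexed-word (column (suc zero)) G (column-outside (suc zero) i (inj₁ ≤-refl)) (column-outside (suc zero) j (inj₂ ≤-refl)) ⟩
    anyIndexed (column (suc zero)) G 0 u₀ ∨ (anyIndexed (column (suc zero)) G i u₁ ∨ anyIndexed (column (suc zero)) G j u₂)
      ≡⟨ cong₂ _∨_ (outside (suc zero) G 0 u₀ (inj₁ (n≤1+n l₀)))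
                   (cong₂ _∨_ (inside (suc zero) G i u₁ ≤-refl ≤-refl) (outside (suc zero) G j u₂ (inj₂ (n≤1+n j)))) ⟩
    any G u₁ ∨ false
      ≡⟨ ∨-identityʳ (any G u₁) ⟩
    any G u₁ ∎
    where
    open ≡-Reasoning
  anyIndexed-column (suc (suc zero)) G = begin
    anyIndexed (column (suc (suc zero))) G 0 word
      ≡⟨ anyIndexed-word (column (suc (suc zero))) G (column-outside (suc (suc zero)) i (inj₁ (<⇒≤ i<j))) (column-outside (suc (suc zero)) j (inj₁ ≤-refl)) ⟩
    anyIndexed (column (suc (suc zero))) G 0 u₀ ∨ (anyIndexed (column (suc (suc zero))) G i u₁ ∨ anyIndexed (column (suc (suc zero))) G j u₂)
      ≡⟨ cong₂ _∨_ (outside (suc (suc zero)) G 0 u₀ (inj₁ (<⇒≤ (<-trans (n<1+n l₀) i<j))))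
                   (cong (_∨ anyIndexed (column (suc (suc zero))) G j u₂) (outside (suc (suc zero)) G i u₁ (inj₁ (n≤1+n (i + l₁))))) ⟩
    anyIndexed (column (suc (suc zero))) G j u₂
      ≡⟨ inside (suc (suc zero)) G j u₂ ≤-refl (s≤s (≤-reflexive j+l₂≡n)) ⟩
    any G u₂ ∎
    where
    open ≡-Reasoning

  boxEmpty-blocks : ∀ a b → boxEmpty word i j (a , b) ≡ not (any (inRow n v₁ v₂ b) (block a))
  boxEmpty-blocks a b = begin
    boxEmpty word i j (a , b)
      ≡⟨ cong not (any-cong (range1 n) (λ k → cong₂ (λ x y → column a k ∧ inRow n x y b (at word k)) at-i at-j)) ⟩
    not (any (λ k → column a (0 + k) ∧ inRow n v₁ v₂ b (at word k)) (range1 n))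
      ≡⟨ cong not (any-at≡anyIndexed (column a) (inRow n v₁ v₂ b) 0 word) ⟩
    not (anyIndexed (column a) (inRow n v₁ v₂ b) 0 word)
      ≡⟨ cong not (anyIndexed-column a (inRow n v₁ v₂ b)) ⟩
    not (any (inRow n v₁ v₂ b) (block a)) ∎
    where
    open ≡-Reasoning

  isOcc-blocks : ∀ R → isOcc R word i j ≡ (v₁ <ᵇ v₂) ∧ all (λ (a , b) → not (any (inRow n v₁ v₂ b) (block a))) R
  isOcc-blocks R rewrite dec-true (i <? j) i<j | at-i | at-j =
    cong ((v₁ <ᵇ v₂) ∧_) (all-cong R (λ (a , b) → boxEmpty-blocks a b))

  Unique-word⁻ : Unique word → (∀ a → Unique (block a)) × (∀ a → All (λ y → y ≢ v₁ × y ≢ v₂) (block a))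
  Unique-word⁻ u with Unique-++⁻ u₀ u
  ... | U₀ , v₁∉ ∷ u′ , disj₀ with Unique-++⁻ u₁ u′
  ...   | U₁ , v₂∉ ∷ U₂ , disj₁ = unique-blocks , avoid-v
    where
    unique-blocks : ∀ a → Unique (block a)
    unique-blocks zero             = U₀
    unique-blocks (suc zero)       = U₁
    unique-blocks (suc (suc zero)) = U₂
    avoid-v : ∀ a → All (λ y → y ≢ v₁ × y ≢ v₂) (block a)
    avoid-v zero             = All.tabulate λ y∈ →
      (λ y≡v₁ → disj₀ (y∈ , here y≡v₁)) , (λ y≡v₂ → disj₀ (y∈ , there (∈-++⁺ʳ u₁ (here y≡v₂))))
    avoid-v (suc zero)       = All.tabulate λ y∈ →
      (λ y≡v₁ → All.lookup v₁∉ (∈-++⁺ˡ y∈) (sym y≡v₁)) , (λ y≡v₂ → disj₁ (y∈ , here y≡v₂))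
    avoid-v (suc (suc zero)) = All.tabulate λ y∈ →
      (λ y≡v₁ → All.lookup v₁∉ (∈-++⁺ʳ u₁ (there y∈)) (sym y≡v₁)) , (λ y≡v₂ → All.lookup v₂∉ y∈ (sym y≡v₂))

  Unique-word⁺ : v₁ ≢ v₂ → (∀ a → Unique (block a)) → (∀ a → All (λ y → y ≢ v₁ × y ≢ v₂) (block a)) →
    (∀ {a a′ y} → y ∈ block a → y ∈ block a′ → a ≡ a′) → Unique word
  Unique-word⁺ v₁≢v₂ unique avoid-v same-block =
    Unique.++⁺ (unique zero) (v₁∉ ∷ Unique.++⁺ (unique (suc zero)) (v₂∉ ∷ unique (suc (suc zero))) disj₁) disj₀
    where
    ≢v₁ : ∀ a {y} → y ∈ block a → y ≢ v₁
    ≢v₁ a y∈ = proj₁ (All.lookup (avoid-v a) y∈)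
    ≢v₂ : ∀ a {y} → y ∈ block a → y ≢ v₂
    ≢v₂ a y∈ = proj₂ (All.lookup (avoid-v a) y∈)
    v₂∉ : All (v₂ ≢_) u₂
    v₂∉ = All.tabulate λ y∈ v₂≡y → ≢v₂ (suc (suc zero)) y∈ (sym v₂≡y)
    v₁∉ : All (v₁ ≢_) (u₁ ++ v₂ ∷ u₂)
    v₁∉ = AllP.++⁺ (All.tabulate λ y∈ v₁≡y → ≢v₁ (suc zero) y∈ (sym v₁≡y))
                   (v₁≢v₂ ∷ All.tabulate λ y∈ v₁≡y → ≢v₁ (suc (suc zero)) y∈ (sym v₁≡y))
    disj₁ : Disjoint u₁ (v₂ ∷ u₂)
    disj₁ (y∈ , here y≡v₂)   = ≢v₂ (suc zero) y∈ y≡v₂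
    disj₁ (y∈ , there y∈u₂) with () ← same-block {suc zero} {suc (suc zero)} y∈ y∈u₂
    disj₀ : Disjoint u₀ (v₁ ∷ u₁ ++ v₂ ∷ u₂)
    disj₀ (y∈ , here y≡v₁)  = ≢v₁ zero y∈ y≡v₁
    disj₀ (y∈ , there y∈′) with ∈-++⁻ u₁ y∈′
    ... | inj₁ y∈u₁         with () ← same-block {zero} {suc zero} y∈ y∈u₁
    ... | inj₂ (here y≡v₂)  = ≢v₂ zero y∈ y≡v₂
    ... | inj₂ (there y∈u₂) with () ← same-block {zero} {suc (suc zero)} y∈ y∈u₂

  ∈-word⁻ : ∀ {y} → y ∈ word → y ≡ v₁ ⊎ y ≡ v₂ ⊎ ∃[ a ] y ∈ block a
  ∈-word⁻ y∈ with ∈-++⁻ u₀ y∈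
  ... | inj₁ y∈u₀ = inj₂ (inj₂ (zero , y∈u₀))
  ... | inj₂ (here y≡v₁) = inj₁ y≡v₁
  ... | inj₂ (there y∈′) with ∈-++⁻ u₁ y∈′
  ...   | inj₁ y∈u₁ = inj₂ (inj₂ (suc zero , y∈u₁))
  ...   | inj₂ (here y≡v₂) = inj₂ (inj₁ y≡v₂)
  ...   | inj₂ (there y∈u₂) = inj₂ (inj₂ (suc (suc zero) , y∈u₂))

  emptyBlock⇒EmptyStrip : ∀ a → block a ≡ [] → EmptyStrip a n i j
  emptyBlock⇒EmptyStrip zero             u₀≡[] = cong (suc ∘′ length) u₀≡[]
  emptyBlock⇒EmptyStrip (suc zero)       u₁≡[] = trans (cong (λ u → suc (suc (l₀ + length u))) u₁≡[]) (cong (suc ∘′ suc) (+-identityʳ l₀))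
  emptyBlock⇒EmptyStrip (suc (suc zero)) u₂≡[] = trans (sym (+-identityʳ j)) (trans (cong ((j +_) ∘′ length) (sym u₂≡[])) j+l₂≡n)

between⇒< : ∀ {lo y hi} → T (lo <ᵇ y <ᵇ hi) → lo < y × y < hi
between⇒< {lo} {y} {hi} t = let (p , q) = Equivalence.to T-∧ t in <ᵇ⇒< lo y p , <ᵇ⇒< y hi q

<⇒between : ∀ {lo y hi} → lo < y → y < hi → T (lo <ᵇ y <ᵇ hi)
<⇒between lo<y y<hi = Equivalence.from T-∧ (<⇒<ᵇ lo<y , <⇒<ᵇ y<hi)

module Rows (n v₁ v₂ : ℕ) (v₁<v₂ : v₁ < v₂) where

  InRow : Fin 3 → ℕ → Set
  InRow b y = T (inRow n v₁ v₂ b y)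

  lo hi : Fin 3 → ℕ
  lo b = proj₁ (bnd n v₁ v₂ b)
  hi b = proj₂ (bnd n v₁ v₂ b)

  row-bounds : ∀ b {y} → InRow b y → lo b < y × y < hi b
  row-bounds b = between⇒<

  bounds-row : ∀ b {y} → lo b < y → y < hi b → InRow b y
  bounds-row b = <⇒between

  inRow⇒≢v₁ : ∀ b {y} → InRow b y → y ≢ v₁
  inRow⇒≢v₁ zero             t refl = <-irrefl refl (proj₂ (row-bounds zero t))
  inRow⇒≢v₁ (suc zero)       t refl = <-irrefl refl (proj₁ (row-bounds (suc zero) t))
  inRow⇒≢v₁ (suc (suc zero)) t refl = <-asym v₁<v₂ (proj₁ (row-bounds (suc (suc zero)) t))

  inRow⇒≢v₂ : ∀ b {y} → InRow b y → y ≢ v₂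
  inRow⇒≢v₂ zero             t refl = <-asym v₁<v₂ (proj₂ (row-bounds zero t))
  inRow⇒≢v₂ (suc zero)       t refl = <-irrefl refl (proj₂ (row-bounds (suc zero) t))
  inRow⇒≢v₂ (suc (suc zero)) t refl = <-irrefl refl (proj₁ (row-bounds (suc (suc zero)) t))

  inRow-unique : ∀ b b′ {y} → InRow b y → InRow b′ y → b ≡ b′
  inRow-unique zero             zero             t t′ = refl
  inRow-unique zero             (suc zero)       t t′ = ⊥-elim (<-asym (proj₂ (row-bounds zero t)) (proj₁ (row-bounds (suc zero) t′)))
  inRow-unique zero             (suc (suc zero)) t t′ = ⊥-elim (<-asym (<-trans (proj₂ (row-bounds zero t)) v₁<v₂) (proj₁ (row-bounds (suc (suc zero)) t′)))
  inRow-unique (suc zero)       zero             t t′ = sym (inRow-unique zero (suc zero) t′ t)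
  inRow-unique (suc zero)       (suc zero)       t t′ = refl
  inRow-unique (suc zero)       (suc (suc zero)) t t′ = ⊥-elim (<-asym (proj₂ (row-bounds (suc zero) t)) (proj₁ (row-bounds (suc (suc zero)) t′)))
  inRow-unique (suc (suc zero)) zero             t t′ = sym (inRow-unique zero (suc (suc zero)) t′ t)
  inRow-unique (suc (suc zero)) (suc zero)       t t′ = sym (inRow-unique (suc zero) (suc (suc zero)) t′ t)
  inRow-unique (suc (suc zero)) (suc (suc zero)) t t′ = refl

  rowOf : ∀ {y} → y ∈[1, n ] → y ≢ v₁ → y ≢ v₂ → ∃[ b ] InRow b y
  rowOf {y} (1≤y , y≤n) y≢v₁ y≢v₂ with <-cmp y v₁
  ... | tri< y<v₁ _ _ = zero , bounds-row zero 1≤y y<v₁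
  ... | tri≈ _ y≡v₁ _ = ⊥-elim (y≢v₁ y≡v₁)
  ... | tri> _ _ v₁<y with <-cmp y v₂
  ...   | tri< y<v₂ _ _ = suc zero , bounds-row (suc zero) v₁<y y<v₂
  ...   | tri≈ _ y≡v₂ _ = ⊥-elim (y≢v₂ y≡v₂)
  ...   | tri> _ _ v₂<y = suc (suc zero) , bounds-row (suc (suc zero)) v₂<y (s≤s y≤n)

  emptyStrip : ∀ b → (∀ {y} → y ∈[1, n ] → ¬ InRow b y) → v₁ ∈[1, n ] → v₂ ∈[1, n ] → EmptyStrip b n v₁ v₂
  emptyStrip zero empty (1≤v₁ , v₁≤n) _ with m≤n⇒m<n∨m≡n 1≤v₁
  ... | inj₂ 1≡v₁ = sym 1≡v₁
  ... | inj₁ 1<v₁ = ⊥-elim (empty (≤-refl , ≤-trans 1≤v₁ v₁≤n) (bounds-row zero ≤-refl 1<v₁))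
  emptyStrip (suc zero) empty _ (_ , v₂≤n) with m≤n⇒m<n∨m≡n v₁<v₂
  ... | inj₂ v₁+1≡v₂ = sym v₁+1≡v₂
  ... | inj₁ v₁+1<v₂ = ⊥-elim (empty (s≤s z≤n , ≤-trans (<⇒≤ v₁+1<v₂) v₂≤n) (bounds-row (suc zero) ≤-refl v₁+1<v₂))
  emptyStrip (suc (suc zero)) empty _ (1≤v₂ , v₂≤n) with m≤n⇒m<n∨m≡n v₂≤n
  ... | inj₂ v₂≡n = v₂≡n
  ... | inj₁ v₂<n = ⊥-elim (empty (≤-trans 1≤v₂ v₂≤n , ≤-refl) (bounds-row (suc (suc zero)) v₂<n ≤-refl))

rowSize : ℕ → ℕ → ℕ → Fin 3 → ℕ
rowSize n v₁ v₂ b = proj₂ (bnd n v₁ v₂ b) ∸ 1 ∸ proj₁ (bnd n v₁ v₂ b)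

count-inRow : ∀ {n v₁ v₂} → v₁ ≤ n → v₂ ≤ n → ∀ b → count n (inRow n v₁ v₂ b) ≡ rowSize n v₁ v₂ b
count-inRow {n} {v₁} v₁≤n v₂≤n zero             = count-interval n 0 v₁ (m≤n⇒m≤1+n v₁≤n)
count-inRow {n} {v₁} v₁≤n v₂≤n (suc zero)       = count-interval n v₁ _ (m≤n⇒m≤1+n v₂≤n)
count-inRow {n} {v₁} v₁≤n v₂≤n (suc (suc zero)) = count-interval n _ (suc n) ≤-refl

rowSize-sum : ∀ {n v₁ v₂} → 1 ≤ v₁ → v₁ < v₂ → v₂ ≤ n →
  suc (suc (rowSize n v₁ v₂ zero + (rowSize n v₁ v₂ (suc zero) + rowSize n v₁ v₂ (suc (suc zero))))) ≡ n
rowSize-sum {n} {suc a} {v₂} (s≤s z≤n) v₁<v₂ v₂≤n with m≤n⇒∃[o]m+o≡n v₁<v₂ | m≤n⇒∃[o]m+o≡n v₂≤n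
... | b , refl | d , refl = begin
  suc (suc (a + (suc a + b ∸ suc a + (suc (suc a) + b + d ∸ (suc (suc a) + b)))))
    ≡⟨ cong (λ z → suc (suc (a + z))) (cong₂ _+_ (m+n∸m≡n (suc a) b) (m+n∸m≡n (suc (suc a) + b) d)) ⟩
  suc (suc (a + (b + d)))
    ≡⟨ cong (λ z → suc (suc z)) (sym (+-assoc a b d)) ⟩
  suc (suc a) + b + d ∎
  where
  open ≡-Reasoning

squeeze : ∀ {s₀ s₁ s₂ t₁ t₂} → t₁ ≤ s₁ → t₂ ≤ s₂ → s₀ + (s₁ + s₂) ≡ t₁ + t₂ → s₀ ≡ 0 × s₁ ≡ t₁ × s₂ ≡ t₂
squeeze {s₀} {s₁} {s₂} {t₁} {t₂} t₁≤s₁ t₂≤s₂ eq = s₀≡0 , s₁≡t₁ , s₂≡t₂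
  where
  s≤t : s₁ + s₂ ≤ t₁ + t₂
  s≤t = subst (s₁ + s₂ ≤_) eq (m≤n+m (s₁ + s₂) s₀)
  s₁≡t₁ : s₁ ≡ t₁
  s₁≡t₁ = ≤-antisym (+-cancelʳ-≤ s₂ s₁ t₁ (≤-trans s≤t (+-monoʳ-≤ t₁ t₂≤s₂))) t₁≤s₁
  s₂≡t₂ : s₂ ≡ t₂
  s₂≡t₂ = ≤-antisym (+-cancelˡ-≤ s₁ s₂ t₂ (subst (λ z → s₁ + s₂ ≤ z + t₂) (sym s₁≡t₁) s≤t)) t₂≤s₂
  s₀≡0 : s₀ ≡ 0
  s₀≡0 = +-cancelʳ-≡ (s₁ + s₂) s₀ 0 (trans eq (cong₂ _+_ (sym s₁≡t₁) (sym s₂≡t₂)))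

strips-determine : ∀ {c r n} → c ≢ r → (f : ℕ → ℕ) → (∀ {k k′} → k ∈[1, n ] → k′ ∈[1, n ] → f k ≡ f k′ → k ≡ k′) →
  ∀ {i j i′ j′} → i ∈[1, n ] → j ∈[1, n ] → i′ ∈[1, n ] → j′ ∈[1, n ] →
  EmptyStrip c n i j → EmptyStrip c n i′ j′ → EmptyStrip r n (f i) (f j) → EmptyStrip r n (f i′) (f j′) → i ≡ i′ × j ≡ j′
strips-determine {zero}           {zero}           c≢r = ⊥-elim (c≢r refl)
strips-determine {suc zero}       {suc zero}       c≢r = ⊥-elim (c≢r refl)
strips-determine {suc (suc zero)} {suc (suc zero)} c≢r = ⊥-elim (c≢r refl)
strips-determine {zero} {suc zero} _ f inj _ j∈ _ j′∈ refl refl fj fj′ =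
  refl , inj j∈ j′∈ (trans fj (sym fj′))
strips-determine {zero} {suc (suc zero)} _ f inj _ j∈ _ j′∈ refl refl fj fj′ =
  refl , inj j∈ j′∈ (trans fj (sym fj′))
strips-determine {suc zero} {zero} _ f inj i∈ _ i′∈ _ refl refl fi fi′ =
  let i≡i′ = inj i∈ i′∈ (trans fi (sym fi′)) in i≡i′ , cong suc i≡i′
strips-determine {suc zero} {suc (suc zero)} _ f inj _ j∈ _ j′∈ refl refl fj fj′ =
  let j≡j′ = inj j∈ j′∈ (trans fj (sym fj′)) in suc-injective j≡j′ , j≡j′
strips-determine {suc (suc zero)} {zero} _ f inj i∈ _ i′∈ _ refl refl fi fi′ =
  inj i∈ i′∈ (trans fi (sym fi′)) , refl
strips-determine {suc (suc zero)} {suc zero} _ f inj i∈ _ i′∈ _ refl refl fj fj′ =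
  inj i∈ i′∈ (suc-injective (trans (sym fj) fj′)) , refl

-- Mesh patterns with two free boxes

data Perm₃ : Fin 3 → Fin 3 → Fin 3 → Set where
  p012 : Perm₃ zero (suc zero) (suc (suc zero))
  p021 : Perm₃ zero (suc (suc zero)) (suc zero)
  p102 : Perm₃ (suc zero) zero (suc (suc zero))
  p120 : Perm₃ (suc zero) (suc (suc zero)) zero
  p201 : Perm₃ (suc (suc zero)) zero (suc zero)
  p210 : Perm₃ (suc (suc zero)) (suc zero) zero

module _ {p q s : Fin 3} where

  Perm₃-cover : Perm₃ p q s → ∀ x → x ≡ p ⊎ x ≡ q ⊎ x ≡ s
  Perm₃-cover p012 zero             = inj₁ refl
  Perm₃-cover p012 (suc zero)       = inj₂ (inj₁ refl)
  Perm₃-cover p012 (suc (suc zero)) = inj₂ (inj₂ refl)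
  Perm₃-cover p021 zero             = inj₁ refl
  Perm₃-cover p021 (suc zero)       = inj₂ (inj₂ refl)
  Perm₃-cover p021 (suc (suc zero)) = inj₂ (inj₁ refl)
  Perm₃-cover p102 zero             = inj₂ (inj₁ refl)
  Perm₃-cover p102 (suc zero)       = inj₁ refl
  Perm₃-cover p102 (suc (suc zero)) = inj₂ (inj₂ refl)
  Perm₃-cover p120 zero             = inj₂ (inj₂ refl)
  Perm₃-cover p120 (suc zero)       = inj₁ refl
  Perm₃-cover p120 (suc (suc zero)) = inj₂ (inj₁ refl)
  Perm₃-cover p201 zero             = inj₂ (inj₁ refl)
  Perm₃-cover p201 (suc zero)       = inj₂ (inj₂ refl)
  Perm₃-cover p201 (suc (suc zero)) = inj₁ refl
  Perm₃-cover p210 zero             = inj₂ (inj₂ refl)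
  Perm₃-cover p210 (suc zero)       = inj₂ (inj₁ refl)
  Perm₃-cover p210 (suc (suc zero)) = inj₁ refl

  Perm₃-distinct : Perm₃ p q s → p ≢ q × p ≢ s × q ≢ s
  Perm₃-distinct p012 = (λ ()) , (λ ()) , (λ ())
  Perm₃-distinct p021 = (λ ()) , (λ ()) , (λ ())
  Perm₃-distinct p102 = (λ ()) , (λ ()) , (λ ())
  Perm₃-distinct p120 = (λ ()) , (λ ()) , (λ ())
  Perm₃-distinct p201 = (λ ()) , (λ ()) , (λ ())
  Perm₃-distinct p210 = (λ ()) , (λ ()) , (λ ())

  module _ (f : Fin 3 → ℕ) where
    open import Data.Nat.Solver using (module +-*-Solver)
    open +-*-Solver

    Perm₃-+ : Perm₃ p q s → f zero + (f (suc zero) + f (suc (suc zero))) ≡ f p + (f q + f s)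
    Perm₃-+ p012 = refl
    Perm₃-+ p021 = solve 3 (λ a b c → a :+ (b :+ c) := a :+ (c :+ b)) refl (f zero) (f (suc zero)) (f (suc (suc zero)))
    Perm₃-+ p102 = solve 3 (λ a b c → a :+ (b :+ c) := b :+ (a :+ c)) refl (f zero) (f (suc zero)) (f (suc (suc zero)))
    Perm₃-+ p120 = solve 3 (λ a b c → a :+ (b :+ c) := b :+ (c :+ a)) refl (f zero) (f (suc zero)) (f (suc (suc zero)))
    Perm₃-+ p201 = solve 3 (λ a b c → a :+ (b :+ c) := c :+ (a :+ b)) refl (f zero) (f (suc zero)) (f (suc (suc zero)))
    Perm₃-+ p210 = solve 3 (λ a b c → a :+ (b :+ c) := c :+ (b :+ a)) refl (f zero) (f (suc zero)) (f (suc (suc zero)))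

    Perm₃-* : Perm₃ p q s → f zero * (f (suc zero) * f (suc (suc zero))) ≡ f p * (f q * f s)
    Perm₃-* p012 = refl
    Perm₃-* p021 = solve 3 (λ a b c → a :* (b :* c) := a :* (c :* b)) refl (f zero) (f (suc zero)) (f (suc (suc zero)))
    Perm₃-* p102 = solve 3 (λ a b c → a :* (b :* c) := b :* (a :* c)) refl (f zero) (f (suc zero)) (f (suc (suc zero)))
    Perm₃-* p120 = solve 3 (λ a b c → a :* (b :* c) := b :* (c :* a)) refl (f zero) (f (suc zero)) (f (suc (suc zero)))
    Perm₃-* p201 = solve 3 (λ a b c → a :* (b :* c) := c :* (a :* b)) refl (f zero) (f (suc zero)) (f (suc (suc zero)))
    Perm₃-* p210 = solve 3 (λ a b c → a :* (b :* c) := c :* (b :* a)) refl (f zero) (f (suc zero)) (f (suc (suc zero)))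

place : {A : Set} → Fin 3 → Fin 3 → A → A → A → Fin 3 → A
place q s x y z a with a Fin.≟ q | a Fin.≟ s
... | yes _ | _     = y
... | no _  | yes _ = z
... | no _  | no _  = x

module _ {p q s : Fin 3} (σ : Perm₃ p q s) {A : Set} (x y z : A) where

  private
    p≢q : p ≢ q
    p≢q = proj₁ (Perm₃-distinct σ)
    p≢s : p ≢ s
    p≢s = proj₁ (proj₂ (Perm₃-distinct σ))
    q≢s : q ≢ s
    q≢s = proj₂ (proj₂ (Perm₃-distinct σ))

  place-p : place q s x y z p ≡ x
  place-p with p Fin.≟ q | p Fin.≟ s
  ... | yes p≡q | _       = ⊥-elim (p≢q p≡q)
  ... | no _    | yes p≡s = ⊥-elim (p≢s p≡s)
  ... | no _    | no _    = refl

  place-q : place q s x y z q ≡ y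
  place-q with q Fin.≟ q
  ... | yes _  = refl
  ... | no q≢q = ⊥-elim (q≢q refl)

  place-s : place q s x y z s ≡ z
  place-s with s Fin.≟ q | s Fin.≟ s
  ... | yes s≡q | _       = ⊥-elim (q≢s (sym s≡q))
  ... | no _    | yes _   = refl
  ... | no _    | no s≢s  = ⊥-elim (s≢s refl)

  place-cases : ∀ a → (a ≡ p × place q s x y z a ≡ x) ⊎ (a ≡ q × place q s x y z a ≡ y) ⊎ (a ≡ s × place q s x y z a ≡ z)
  place-cases a with Perm₃-cover σ a
  ... | inj₁ refl        = inj₁ (refl , place-p)
  ... | inj₂ (inj₁ refl) = inj₂ (inj₁ (refl , place-q))
  ... | inj₂ (inj₂ refl) = inj₂ (inj₂ (refl , place-s))

Box : Set
Box = Fin 3 × Fin 3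

_≟-box_ : DecidableEquality Box
_≟-box_ = ≡-dec Fin._≟_ Fin._≟_

open import Data.List.Membership.DecPropositional _≟-box_ using (_∈?_)

freeRow : Box → Box → Fin 3 → Maybe (Fin 3)
freeRow (a₁ , b₁) (a₂ , b₂) = place a₁ a₂ nothing (just b₁) (just b₂)

record Shape (R : MeshR) : Set where
  field
    {c a₁ a₂ r b₁ b₂} : Fin 3
    columns : Perm₃ c a₁ a₂
    rows    : Perm₃ r b₁ b₂
    c≢r     : c ≢ r
    shaded⇔ : ∀ a b → (a , b) ∈ R ⇔ freeRow (a₁ , b₁) (a₂ , b₂) a ≢ just b

_⇔?_ : {A B : Set} → Dec A → Dec B → Dec (A ⇔ B)
A? ⇔? B? = map′ (λ (f , g) → mk⇔ f g) (λ e → Equivalence.to e , Equivalence.from e) ((A? →-dec B?) ×-dec (B? →-dec A?))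

everyBox : (Fin 3 → Fin 3 → Bool) → Bool
everyBox p = all (λ a → all (p a) (allFin 3)) (allFin 3)

∀-by-evaluation : {P : Fin 3 → Fin 3 → Set} (P? : ∀ a b → Dec (P a b)) → T (everyBox λ a b → isYes (P? a b)) → ∀ a b → P a b
∀-by-evaluation P? t a b = toWitness {a? = P? a b}
  (All.lookup (all⁺ (λ b → isYes (P? a b)) (allFin 3) (All.lookup (all⁺ (λ a → all (λ b → isYes (P? a b)) (allFin 3)) (allFin 3) t) (∈-allFin a)))
              (∈-allFin b))

shaded⇔? : ∀ R f₁ f₂ a b → Dec ((a , b) ∈ R ⇔ freeRow f₁ f₂ a ≢ just b)
shaded⇔? R f₁ f₂ a b = ((a , b) ∈? R) ⇔? ¬? (Maybe.≡-dec Fin._≟_ (freeRow f₁ f₂ a) (just b))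

-- For a concrete R the implicit check evaluates to ⊤ and is filled in automatically.
twoFree : ∀ {R c a₁ a₂ r b₁ b₂} → Perm₃ c a₁ a₂ → Perm₃ r b₁ b₂ → c ≢ r →
  {T (everyBox λ a b → isYes (shaded⇔? R (a₁ , b₁) (a₂ , b₂) a b))} → Shape R
twoFree columns rows c≢r {shading} =
  record { columns = columns ; rows = rows ; c≢r = c≢r ; shaded⇔ = ∀-by-evaluation (shaded⇔? _ _ _) shading }

-- falling 0 x is 1 if x ≡ 0 and 0 otherwise.
weight : Fin 3 → ℕ → ℕ → ℕ → ℕ
weight zero             x₀ x₁ x₂ = falling 0 x₀ * (x₁ ! * x₂ !)
weight (suc zero)       x₀ x₁ x₂ = falling 0 x₁ * (x₀ ! * x₂ !)
weight (suc (suc zero)) x₀ x₁ x₂ = falling 0 x₂ * (x₀ ! * x₁ !)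

weight-Perm₃ : ∀ {c a₁ a₂} → Perm₃ c a₁ a₂ → ∀ x₀ x₁ x₂ →
  falling 0 (pick c x₀ x₁ x₂) * (pick a₁ x₀ x₁ x₂ ! * pick a₂ x₀ x₁ x₂ !) ≡ weight c x₀ x₁ x₂
weight-Perm₃ p012 x₀ x₁ x₂ = refl
weight-Perm₃ p021 x₀ x₁ x₂ = cong (falling 0 x₀ *_) (*-comm (x₂ !) (x₁ !))
weight-Perm₃ p102 x₀ x₁ x₂ = refl
weight-Perm₃ p120 x₀ x₁ x₂ = cong (falling 0 x₁ *_) (*-comm (x₂ !) (x₀ !))
weight-Perm₃ p201 x₀ x₁ x₂ = refl
weight-Perm₃ p210 x₀ x₁ x₂ = cong (falling 0 x₂ *_) (*-comm (x₁ !) (x₀ !))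

A-suc : ∀ m → A (suc m) ≡ ∑ (range1 m) (λ i → (i ∸ 1) ! * (m ∸ i) !)
A-suc m = trans (sum-map (range1 m) _) (∑-cong (range1 m) λ i →
  cong (λ k → (i ∸ 1) ! * k !) (trans (∸-+-assoc (suc m) i 1) (cong (suc m ∸_) (+-comm i 1))))

A≡∑-below : ∀ n → A n ≡ ∑ (range1 n) (λ i → ⟦ i <ᵇ n ⟧ * ((i ∸ 1) ! * (n ∸ suc i) !))
A≡∑-below zero    = refl
A≡∑-below (suc m) = begin
  A (suc m)
    ≡⟨ A-suc m ⟩
  ∑ (range1 m) (λ i → (i ∸ 1) ! * (m ∸ i) !)
    ≡⟨ ∑-range1-cong m (λ {i} (_ , i≤m) → sym (trans (cong (λ b → ⟦ b ⟧ * ((i ∸ 1) ! * (m ∸ i) !)) (dec-true (i <? suc m) (s≤s i≤m))) (*-identityˡ _))) ⟩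
  ∑ (range1 m) f
    ≡⟨ +-identityʳ _ ⟨
  ∑ (range1 m) f + 0
    ≡⟨ cong (λ b → ∑ (range1 m) f + ⟦ b ⟧ * ((m ∸ 0) ! * (m ∸ suc m) !)) (dec-false (suc m <? suc m) (<-irrefl refl)) ⟨
  ∑ (range1 m) f + f (suc m)
    ≡⟨ ∑-range1-suc m f ⟨
  ∑ (range1 (suc m)) f ∎
  where
  open ≡-Reasoning
  f : ℕ → ℕ
  f i = ⟦ i <ᵇ suc m ⟧ * ((i ∸ 1) ! * (suc m ∸ suc i) !)

∑-right-after : ∀ n i (h : ℕ → ℕ) → ∑ (range1 n) (λ j → ⟦ i <ᵇ j ⟧ * (falling 0 (j ∸ suc i) * h j)) ≡ ⟦ i <ᵇ n ⟧ * h (suc i)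
∑-right-after n i h with i <? n
... | yes i<n = begin
  ∑ (range1 n) f
    ≡⟨ ∑-range1-single n f (s≤s z≤n , i<n) vanish ⟩
  ⟦ i <ᵇ suc i ⟧ * (falling 0 (suc i ∸ suc i) * h (suc i))
    ≡⟨ cong₂ (λ b k → ⟦ b ⟧ * (falling 0 k * h (suc i))) (dec-true (i <? suc i) ≤-refl) (n∸n≡0 i) ⟩
  1 * (1 * h (suc i))
    ≡⟨ cong (λ b → ⟦ b ⟧ * (1 * h (suc i))) (dec-true (i <? n) i<n) ⟨
  ⟦ i <ᵇ n ⟧ * (1 * h (suc i))
    ≡⟨ cong (⟦ i <ᵇ n ⟧ *_) (*-identityˡ (h (suc i))) ⟩
  ⟦ i <ᵇ n ⟧ * h (suc i) ∎
  where
  open ≡-Reasoning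
  f : ℕ → ℕ
  f j = ⟦ i <ᵇ j ⟧ * (falling 0 (j ∸ suc i) * h j)
  vanish : ∀ {j} → j ∈[1, n ] → j ≢ suc i → f j ≡ 0
  vanish {j} _ j≢i+1 with i <? j
  ... | no  i≮j = cong (λ b → ⟦ b ⟧ * (falling 0 (j ∸ suc i) * h j)) (dec-false (i <? j) i≮j)
  ... | yes i<j = trans (cong (λ k → ⟦ i <ᵇ j ⟧ * (k * h j)) (falling-0-∸ (≤∧≢⇒< i<j (j≢i+1 ∘′ sym)))) (*-zeroʳ ⟦ i <ᵇ j ⟧)
... | no i≮n = trans (∑-range1-zero n _ λ {j} (_ , j≤n) → cong (λ b → ⟦ b ⟧ * (falling 0 (j ∸ suc i) * h j)) (dec-false (i <? j) (λ i<j → i≮n (<-≤-trans i<j j≤n))))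
                     (sym (cong (λ b → ⟦ b ⟧ * h (suc i)) (dec-false (i <? n) i≮n)))

∑-last : ∀ n {i} → i ∈[1, n ] → (h : ℕ → ℕ) → ∑ (range1 n) (λ j → ⟦ i <ᵇ j ⟧ * (falling 0 (n ∸ j) * h j)) ≡ ⟦ i <ᵇ n ⟧ * h n
∑-last n {i} (1≤i , i≤n) h = begin
  ∑ (range1 n) f
    ≡⟨ ∑-range1-single n f (≤-trans 1≤i i≤n , ≤-refl) vanish ⟩
  ⟦ i <ᵇ n ⟧ * (falling 0 (n ∸ n) * h n)
    ≡⟨ cong (λ k → ⟦ i <ᵇ n ⟧ * (falling 0 k * h n)) (n∸n≡0 n) ⟩
  ⟦ i <ᵇ n ⟧ * (1 * h n)
    ≡⟨ cong (⟦ i <ᵇ n ⟧ *_) (*-identityˡ (h n)) ⟩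
  ⟦ i <ᵇ n ⟧ * h n ∎
  where
  open ≡-Reasoning
  f : ℕ → ℕ
  f j = ⟦ i <ᵇ j ⟧ * (falling 0 (n ∸ j) * h j)
  vanish : ∀ {j} → j ∈[1, n ] → j ≢ n → f j ≡ 0
  vanish {j} (_ , j≤n) j≢n = trans (cong (λ k → ⟦ i <ᵇ j ⟧ * (k * h j)) (falling-0-∸ (≤∧≢⇒< j≤n j≢n))) (*-zeroʳ ⟦ i <ᵇ j ⟧)

∑-positions : ∀ c n → (∑ (range1 n) λ i → ∑ (range1 n) λ j → ⟦ i <ᵇ j ⟧ * weight c (i ∸ 1) (j ∸ suc i) (n ∸ j)) ≡ A n
∑-positions zero zero = refl
∑-positions zero (suc m) = begin
  (∑ (range1 (suc m)) λ i → ∑ (range1 (suc m)) λ j → ⟦ i <ᵇ j ⟧ * weight zero (i ∸ 1) (j ∸ suc i) (suc m ∸ j))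
    ≡⟨ ∑-range1-single (suc m) _ (≤-refl , s≤s z≤n) (λ {i} i∈ i≢1 → ∑-range1-zero (suc m) _ λ {j} _ → first-only {i} {j} i∈ i≢1) ⟩
  ∑ (range1 (suc m)) (λ j → ⟦ 1 <ᵇ j ⟧ * weight zero 0 (j ∸ 2) (suc m ∸ j))
    ≡⟨ ∑-range1-cons m (λ j → ⟦ 1 <ᵇ j ⟧ * weight zero 0 (j ∸ 2) (suc m ∸ j)) ⟩
  0 + ∑ (range1 m) (λ j → ⟦ 1 <ᵇ suc j ⟧ * weight zero 0 (suc j ∸ 2) (m ∸ j))
    ≡⟨ ∑-range1-cong m (λ { {suc j} _ → trans (*-identityˡ _) (*-identityˡ _) }) ⟩
  ∑ (range1 m) (λ i → (i ∸ 1) ! * (m ∸ i) !)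
    ≡⟨ A-suc m ⟨
  A (suc m) ∎
  where
  open ≡-Reasoning
  first-only : ∀ {i j} → i ∈[1, suc m ] → i ≢ 1 → ⟦ i <ᵇ j ⟧ * weight zero (i ∸ 1) (j ∸ suc i) (suc m ∸ j) ≡ 0
  first-only {suc zero}    _ i≢1 = ⊥-elim (i≢1 refl)
  first-only {suc (suc _)} {j} _ _ = *-zeroʳ ⟦ _ <ᵇ j ⟧
∑-positions (suc zero) n = trans
  (∑-range1-cong n λ {i} _ → ∑-right-after n i (λ j → (i ∸ 1) ! * (n ∸ j) !)) (sym (A≡∑-below n))
∑-positions (suc (suc zero)) n = trans
  (∑-range1-cong n λ {i} i∈ → ∑-last n i∈ (λ j → (i ∸ 1) ! * (j ∸ suc i) !)) (sym (A≡∑-below n))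

module Occurrences {R : MeshR} (S : Shape R) where

  open Shape S

  ρ : Fin 3 → Maybe (Fin 3)
  ρ = freeRow (a₁ , b₁) (a₂ , b₂)

  private
    r≢b₁ : r ≢ b₁
    r≢b₁ = proj₁ (Perm₃-distinct rows)
    r≢b₂ : r ≢ b₂
    r≢b₂ = proj₁ (proj₂ (Perm₃-distinct rows))
    b₁≢b₂ : b₁ ≢ b₂
    b₁≢b₂ = proj₂ (proj₂ (Perm₃-distinct rows))

  ρ-c : ρ c ≡ nothing
  ρ-c = place-p columns nothing (just b₁) (just b₂)

  ρ-a₁ : ρ a₁ ≡ just b₁
  ρ-a₁ = place-q columns nothing (just b₁) (just b₂)

  ρ-a₂ : ρ a₂ ≡ just b₂
  ρ-a₂ = place-s columns nothing (just b₁) (just b₂)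

  ρ-just : ∀ {a b} → ρ a ≡ just b → (a ≡ a₁ × b ≡ b₁) ⊎ (a ≡ a₂ × b ≡ b₂)
  ρ-just {a} eq with place-cases columns nothing (just b₁) (just b₂) a
  ... | inj₁ (_ , ρa≡nothing)       with () ← trans (sym eq) ρa≡nothing
  ... | inj₂ (inj₁ (a≡a₁ , ρa≡b₁)) = inj₁ (a≡a₁ , Maybe.just-injective (trans (sym eq) ρa≡b₁))
  ... | inj₂ (inj₂ (a≡a₂ , ρa≡b₂)) = inj₂ (a≡a₂ , Maybe.just-injective (trans (sym eq) ρa≡b₂))

  ρ-injective : ∀ {a a′ b} → ρ a ≡ just b → ρ a′ ≡ just b → a ≡ a′
  ρ-injective eq eq′ with ρ-just eq | ρ-just eq′
  ... | inj₁ (refl , refl) | inj₁ (refl , _)    = refl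
  ... | inj₁ (_ , refl)    | inj₂ (_ , b₁≡b₂)   = ⊥-elim (b₁≢b₂ b₁≡b₂)
  ... | inj₂ (_ , refl)    | inj₁ (_ , b₂≡b₁)   = ⊥-elim (b₁≢b₂ (sym b₂≡b₁))
  ... | inj₂ (refl , refl) | inj₂ (refl , _)    = refl

  ρ-≢r : ∀ a → ρ a ≢ just r
  ρ-≢r a eq with ρ-just eq
  ... | inj₁ (_ , r≡b₁) = r≢b₁ r≡b₁
  ... | inj₂ (_ , r≡b₂) = r≢b₂ r≡b₂

  free-if-unshaded : ∀ {a b} → ¬ (a , b) ∈ R → ρ a ≡ just b
  free-if-unshaded {a} {b} ∉R with Maybe.≡-dec Fin._≟_ (ρ a) (just b)
  ... | yes eq = eq
  ... | no neq = ⊥-elim (∉R (Equivalence.from (shaded⇔ a b) neq))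

  InFreeRow : ℕ → ℕ → ℕ → Fin 3 → ℕ → Set
  InFreeRow n v₁ v₂ a y = T (inRowᵐ n v₁ v₂ (ρ a) y)

  InFreeRow⇒ : ∀ {n v₁ v₂ a y} → InFreeRow n v₁ v₂ a y → ∃[ b ] ρ a ≡ just b × T (inRow n v₁ v₂ b y)
  InFreeRow⇒ {n} {v₁} {v₂} {a} t with ρ a
  ... | just b = b , refl , t

  fits : ℕ → ℕ → ℕ → Fin 3 → List ℕ → Bool
  fits n v₁ v₂ a u = distinct u ∧ all (inRowᵐ n v₁ v₂ (ρ a)) u

  module Characterisation (u₀ : List ℕ) (v₁ : ℕ) (u₁ : List ℕ) (v₂ : ℕ) (u₂ : List ℕ) where

    open Blocks u₀ v₁ u₁ v₂ u₂ public

    Fits : Fin 3 → Set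
    Fits a = Unique (block a) × All (InFreeRow n v₁ v₂ a) (block a)

    ShadedEmpty : Set
    ShadedEmpty = ∀ {a b} → (a , b) ∈ R → All (λ y → ¬ T (inRow n v₁ v₂ b y)) (block a)

    block⊆word : ∀ a {y} → y ∈ block a → y ∈ word
    block⊆word zero             y∈ = ∈-++⁺ˡ y∈
    block⊆word (suc zero)       y∈ = ∈-++⁺ʳ u₀ (there (∈-++⁺ˡ y∈))
    block⊆word (suc (suc zero)) y∈ = ∈-++⁺ʳ u₀ (there (∈-++⁺ʳ u₁ (there y∈)))

    fits-if-occurrence : All (_∈[1, n ]) word → Unique word → v₁ < v₂ → ShadedEmpty → ∀ a → Fits a
    fits-if-occurrence word∈ unique v₁<v₂ empty a = proj₁ (Unique-word⁻ unique) a , All.tabulate in-free-row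
      where
      open Rows n v₁ v₂ v₁<v₂
      avoid-v : ∀ {y} → y ∈ block a → y ≢ v₁ × y ≢ v₂
      avoid-v = All.lookup (proj₂ (Unique-word⁻ unique) a)
      in-free-row : ∀ {y} → y ∈ block a → InFreeRow n v₁ v₂ a y
      in-free-row {y} y∈ with rowOf (All.lookup word∈ (block⊆word a y∈)) (proj₁ (avoid-v y∈)) (proj₂ (avoid-v y∈))
      ... | b , y∈b with (a , b) ∈? R
      ...   | yes ab∈R = ⊥-elim (All.lookup (empty ab∈R) y∈ y∈b)
      ...   | no ab∉R  = subst (λ m → T (inRowᵐ n v₁ v₂ m y)) (sym (free-if-unshaded ab∉R)) y∈b

    occurrence-if-fits : v₁ < v₂ → (∀ a → Fits a) → Unique word × ShadedEmpty
    occurrence-if-fits v₁<v₂ fits = Unique-word⁺ (<⇒≢ v₁<v₂) (λ a → proj₁ (fits a)) avoid-v same-block , empty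
      where
      open Rows n v₁ v₂ v₁<v₂
      row : ∀ {a y} → y ∈ block a → ∃[ b ] ρ a ≡ just b × InRow b y
      row {a} y∈ = InFreeRow⇒ (All.lookup (proj₂ (fits a)) y∈)
      avoid-v : ∀ a → All (λ y → y ≢ v₁ × y ≢ v₂) (block a)
      avoid-v a = All.tabulate λ y∈ → let (b , _ , y∈b) = row y∈ in inRow⇒≢v₁ b y∈b , inRow⇒≢v₂ b y∈b
      same-block : ∀ {a a′ y} → y ∈ block a → y ∈ block a′ → a ≡ a′
      same-block y∈ y∈′ with row y∈ | row y∈′
      ... | b , ρa≡b , y∈b | b′ , ρa′≡b′ , y∈b′ rewrite inRow-unique b b′ y∈b y∈b′ = ρ-injective ρa≡b ρa′≡b′
      empty : ShadedEmpty
      empty {a} {b} ab∈R = All.tabulate λ y∈ y∈b → let (b′ , ρa≡b′ , y∈b′) = row y∈ in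
        Equivalence.to (shaded⇔ a b) ab∈R (subst (λ b″ → ρ a ≡ just b″) (inRow-unique b′ b y∈b′ y∈b) ρa≡b′)

    fits⇔Fits : ∀ a → T (fits n v₁ v₂ a (block a)) ⇔ Fits a
    fits⇔Fits a = mk⇔
      (λ t → let (d , inside) = Equivalence.to T-∧ t in distinct⇒Unique (block a) d , all⁺ _ (block a) inside)
      (λ (u , inside) → Equivalence.from T-∧ (Unique⇒distinct u , all⁻ _ inside))

    emptyBox : Box → Bool
    emptyBox (a , b) = not (any (inRow n v₁ v₂ b) (block a))

    shadedEmpty⇔ : T (all emptyBox R) ⇔ ShadedEmpty
    shadedEmpty⇔ = mk⇔
      (λ t {a} {b} ab∈R → Equivalence.to (T-notAny⇔All¬ _ (block a)) (All.lookup (all⁺ emptyBox R t) ab∈R))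
      (λ empty → all⁻ emptyBox (All.tabulate λ {(a , b)} ab∈R → Equivalence.from (T-notAny⇔All¬ _ (block a)) (empty ab∈R)))

    allFit : Bool
    allFit = fits n v₁ v₂ zero u₀ ∧ (fits n v₁ v₂ (suc zero) u₁ ∧ fits n v₁ v₂ (suc (suc zero)) u₂)

    allFit⇔ : T allFit ⇔ (∀ a → Fits a)
    allFit⇔ = mk⇔ every (λ F → from (T-∧ {fits n v₁ v₂ zero u₀}) (from (fits⇔Fits zero) (F zero) ,
                                  from (T-∧ {fits n v₁ v₂ (suc zero) u₁}) (from (fits⇔Fits (suc zero)) (F (suc zero)) ,
                                                                         from (fits⇔Fits (suc (suc zero))) (F (suc (suc zero))))))
      where
      open Equivalence using (to; from)
      every : T allFit → ∀ a → Fits a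
      every t zero             = to (fits⇔Fits zero) (proj₁ (to (T-∧ {fits n v₁ v₂ zero u₀}) t))
      every t (suc zero)       = to (fits⇔Fits (suc zero)) (proj₁ (to (T-∧ {fits n v₁ v₂ (suc zero) u₁}) (proj₂ (to (T-∧ {fits n v₁ v₂ zero u₀}) t))))
      every t (suc (suc zero)) = to (fits⇔Fits (suc (suc zero))) (proj₂ (to (T-∧ {fits n v₁ v₂ (suc zero) u₁}) (proj₂ (to (T-∧ {fits n v₁ v₂ zero u₀}) t))))

    occurrence≡fits : All (_∈[1, n ]) word → (distinct word ∧ isOcc R word i j) ≡ (v₁ <ᵇ v₂) ∧ allFit
    occurrence≡fits word∈ rewrite isOcc-blocks R = T-injective fwd bwd
      where
      open Equivalence using (to; from)
      fwd : T (distinct word ∧ ((v₁ <ᵇ v₂) ∧ all emptyBox R)) → T ((v₁ <ᵇ v₂) ∧ allFit)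
      fwd t = let (d , t′) = to (T-∧ {distinct word}) t ; (lt , e) = to (T-∧ {v₁ <ᵇ v₂}) t′ in
        from (T-∧ {v₁ <ᵇ v₂}) (lt , from allFit⇔ (fits-if-occurrence word∈ (distinct⇒Unique word d) (<ᵇ⇒< v₁ v₂ lt) (to shadedEmpty⇔ e)))
      bwd : T ((v₁ <ᵇ v₂) ∧ allFit) → T (distinct word ∧ ((v₁ <ᵇ v₂) ∧ all emptyBox R))
      bwd t = let (lt , fs) = to (T-∧ {v₁ <ᵇ v₂}) t ; (unique , empty) = occurrence-if-fits (<ᵇ⇒< v₁ v₂ lt) (to allFit⇔ fs) in
        from (T-∧ {distinct word}) (Unique⇒distinct unique , from (T-∧ {v₁ <ᵇ v₂}) (lt , from shadedEmpty⇔ empty))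

  occurrence-indicator : ∀ {x₀ x₁ x₂} u₀ v₁ u₁ v₂ u₂ → length u₀ ≡ x₀ → length u₁ ≡ x₁ → length u₂ ≡ x₂ →
    All (_∈[1, x₀ + suc (x₁ + suc x₂) ]) (u₀ ++ v₁ ∷ u₁ ++ v₂ ∷ u₂) →
    ⟦ distinct (u₀ ++ v₁ ∷ u₁ ++ v₂ ∷ u₂) ⟧ * ⟦ isOcc R (u₀ ++ v₁ ∷ u₁ ++ v₂ ∷ u₂) (suc x₀) (suc (suc (x₀ + x₁))) ⟧
    ≡ ⟦ v₁ <ᵇ v₂ ⟧ * (⟦ fits (x₀ + suc (x₁ + suc x₂)) v₁ v₂ zero u₀ ⟧ *
        (⟦ fits (x₀ + suc (x₁ + suc x₂)) v₁ v₂ (suc zero) u₁ ⟧ * ⟦ fits (x₀ + suc (x₁ + suc x₂)) v₁ v₂ (suc (suc zero)) u₂ ⟧))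
  occurrence-indicator u₀ v₁ u₁ v₂ u₂ refl refl refl word∈ = begin
    ⟦ distinct word ⟧ * ⟦ isOcc R word i j ⟧
      ≡⟨ ⟦∧⟧ (distinct word) _ ⟨
    ⟦ distinct word ∧ isOcc R word i j ⟧
      ≡⟨ cong ⟦_⟧ (occurrence≡fits (subst (λ m → All (_∈[1, m ]) word) (sym length-word) word∈)) ⟩
    ⟦ (v₁ <ᵇ v₂) ∧ (fits n v₁ v₂ zero u₀ ∧ (fits n v₁ v₂ (suc zero) u₁ ∧ fits n v₁ v₂ (suc (suc zero)) u₂)) ⟧
      ≡⟨ cong (λ m → ⟦ (v₁ <ᵇ v₂) ∧ (fits m v₁ v₂ zero u₀ ∧ (fits m v₁ v₂ (suc zero) u₁ ∧ fits m v₁ v₂ (suc (suc zero)) u₂)) ⟧) length-word ⟩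
    ⟦ (v₁ <ᵇ v₂) ∧ (fits m v₁ v₂ zero u₀ ∧ (fits m v₁ v₂ (suc zero) u₁ ∧ fits m v₁ v₂ (suc (suc zero)) u₂)) ⟧
      ≡⟨ ⟦∧⟧ (v₁ <ᵇ v₂) _ ⟩
    ⟦ v₁ <ᵇ v₂ ⟧ * ⟦ fits m v₁ v₂ zero u₀ ∧ (fits m v₁ v₂ (suc zero) u₁ ∧ fits m v₁ v₂ (suc (suc zero)) u₂) ⟧
      ≡⟨ cong (⟦ v₁ <ᵇ v₂ ⟧ *_) (trans (⟦∧⟧ (fits m v₁ v₂ zero u₀) _) (cong (⟦ fits m v₁ v₂ zero u₀ ⟧ *_) (⟦∧⟧ (fits m v₁ v₂ (suc zero) u₁) _))) ⟩
    ⟦ v₁ <ᵇ v₂ ⟧ * (⟦ fits m v₁ v₂ zero u₀ ⟧ * (⟦ fits m v₁ v₂ (suc zero) u₁ ⟧ * ⟦ fits m v₁ v₂ (suc (suc zero)) u₂ ⟧)) ∎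
    where
    open ≡-Reasoning
    open Characterisation u₀ v₁ u₁ v₂ u₂
    m : ℕ
    m = length u₀ + suc (length u₁ + suc (length u₂))

  rowCount : ℕ → ℕ → ℕ → Fin 3 → ℕ
  rowCount n v₁ v₂ a = count n (inRowᵐ n v₁ v₂ (ρ a))

  occurrencesAt-rows : ∀ x₀ x₁ x₂ → let n = x₀ + suc (x₁ + suc x₂) in
    occurrencesAt R n (suc x₀) (suc (suc (x₀ + x₁)))
    ≡ (∑ (range1 n) λ v₁ → ∑ (range1 n) λ v₂ →
         ⟦ v₁ <ᵇ v₂ ⟧ * (falling (rowCount n v₁ v₂ zero) x₀ * (falling (rowCount n v₁ v₂ (suc zero)) x₁ * falling (rowCount n v₁ v₂ (suc (suc zero))) x₂)))
  occurrencesAt-rows x₀ x₁ x₂ = begin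
    occurrencesAt R n i j
      ≡⟨ ∑-perms n _ ⟩
    ∑ (words n n) (λ w → ⟦ distinct w ⟧ * ⟦ isOcc R w i j ⟧)
      ≡⟨ ∑-words-blocks x₀ x₁ x₂ n _ ⟩
    (∑ (words x₀ n) λ u₀ → ∑ V λ v₁ → ∑ (words x₁ n) λ u₁ → ∑ V λ v₂ → ∑ (words x₂ n) λ u₂ →
       ⟦ distinct (u₀ ++ v₁ ∷ u₁ ++ v₂ ∷ u₂) ⟧ * ⟦ isOcc R (u₀ ++ v₁ ∷ u₁ ++ v₂ ∷ u₂) i j ⟧)
      ≡⟨ ∑-words-cong x₀ n (λ (len₀ , u₀∈) → ∑-range1-cong n λ v₁∈ → ∑-words-cong x₁ n λ (len₁ , u₁∈) → ∑-range1-cong n λ v₂∈ →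
           ∑-words-cong x₂ n λ (len₂ , u₂∈) → occurrence-indicator _ _ _ _ _ len₀ len₁ len₂ (AllP.++⁺ u₀∈ (v₁∈ ∷ AllP.++⁺ u₁∈ (v₂∈ ∷ u₂∈)))) ⟩
    (∑ (words x₀ n) λ u₀ → ∑ V λ v₁ → ∑ (words x₁ n) λ u₁ → ∑ V λ v₂ → ∑ (words x₂ n) λ u₂ →
       ⟦ v₁ <ᵇ v₂ ⟧ * (⟦ fits n v₁ v₂ zero u₀ ⟧ * (⟦ fits n v₁ v₂ (suc zero) u₁ ⟧ * ⟦ fits n v₁ v₂ (suc (suc zero)) u₂ ⟧)))
      ≡⟨ ∑-interleaved-factor (words x₀ n) (words x₁ n) (words x₂ n) V (λ v₁ v₂ → ⟦ v₁ <ᵇ v₂ ⟧)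
           (λ v₁ v₂ u → ⟦ fits n v₁ v₂ zero u ⟧) (λ v₁ v₂ u → ⟦ fits n v₁ v₂ (suc zero) u ⟧) (λ v₁ v₂ u → ⟦ fits n v₁ v₂ (suc (suc zero)) u ⟧) ⟩
    (∑ V λ v₁ → ∑ V λ v₂ → ⟦ v₁ <ᵇ v₂ ⟧ * (∑ (words x₀ n) (λ u → ⟦ fits n v₁ v₂ zero u ⟧) *
       (∑ (words x₁ n) (λ u → ⟦ fits n v₁ v₂ (suc zero) u ⟧) * ∑ (words x₂ n) (λ u → ⟦ fits n v₁ v₂ (suc (suc zero)) u ⟧))))
      ≡⟨ ∑-cong V (λ v₁ → ∑-cong V λ v₂ → cong (⟦ v₁ <ᵇ v₂ ⟧ *_) (cong₂ _*_ (∑-words-injective x₀ n _)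
           (cong₂ _*_ (∑-words-injective x₁ n _) (∑-words-injective x₂ n _)))) ⟩
    (∑ V λ v₁ → ∑ V λ v₂ →
       ⟦ v₁ <ᵇ v₂ ⟧ * (falling (rowCount n v₁ v₂ zero) x₀ * (falling (rowCount n v₁ v₂ (suc zero)) x₁ * falling (rowCount n v₁ v₂ (suc (suc zero))) x₂))) ∎
    where
    open ≡-Reasoning
    n i j : ℕ
    n = x₀ + suc (x₁ + suc x₂)
    i = suc x₀
    j = suc (suc (x₀ + x₁))
    V : List ℕ
    V = range1 n

  rowCount-c : ∀ {n v₁ v₂} → rowCount n v₁ v₂ c ≡ 0
  rowCount-c {n} {v₁} {v₂} = trans (cong (λ m → count n (inRowᵐ n v₁ v₂ m)) ρ-c) (∑-zero (range1 n))

  rowCount-a₁ : ∀ {n v₁ v₂} → v₁ ≤ n → v₂ ≤ n → rowCount n v₁ v₂ a₁ ≡ rowSize n v₁ v₂ b₁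
  rowCount-a₁ {n} {v₁} {v₂} v₁≤n v₂≤n = trans (cong (λ m → count n (inRowᵐ n v₁ v₂ m)) ρ-a₁) (count-inRow v₁≤n v₂≤n b₁)

  rowCount-a₂ : ∀ {n v₁ v₂} → v₁ ≤ n → v₂ ≤ n → rowCount n v₁ v₂ a₂ ≡ rowSize n v₁ v₂ b₂
  rowCount-a₂ {n} {v₁} {v₂} v₁≤n v₂≤n = trans (cong (λ m → count n (inRowᵐ n v₁ v₂ m)) ρ-a₂) (count-inRow v₁≤n v₂≤n b₂)

  module ColumnSizes (x₀ x₁ x₂ : ℕ) where

    n : ℕ
    n = x₀ + suc (x₁ + suc x₂)

    x : Fin 3 → ℕ
    x a = pick a x₀ x₁ x₂

    fillings : ℕ → ℕ → ℕ
    fillings v₁ v₂ = falling 0 (x c) * (falling (rowSize n v₁ v₂ b₁) (x a₁) * falling (rowSize n v₁ v₂ b₂) (x a₂))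

    product≡fillings : ∀ {v₁ v₂} → v₁ ∈[1, n ] → v₂ ∈[1, n ] →
      falling (rowCount n v₁ v₂ zero) x₀ * (falling (rowCount n v₁ v₂ (suc zero)) x₁ * falling (rowCount n v₁ v₂ (suc (suc zero))) x₂)
      ≡ fillings v₁ v₂
    product≡fillings {v₁} {v₂} (_ , v₁≤n) (_ , v₂≤n) = trans (Perm₃-* (λ a → falling (rowCount n v₁ v₂ a) (x a)) columns)
      (cong₂ _*_ (cong (λ k → falling k (x c)) (rowCount-c {n} {v₁} {v₂}))
                 (cong₂ _*_ (cong (λ k → falling k (x a₁)) (rowCount-a₁ v₁≤n v₂≤n)) (cong (λ k → falling k (x a₂)) (rowCount-a₂ v₁≤n v₂≤n))))

    n≡ : n ≡ suc (suc (x c + (x a₁ + x a₂)))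
    n≡ = trans (+-suc-suc x₀ x₁ x₂) (cong (suc ∘′ suc) (Perm₃-+ x columns))

    y* : Fin 3 → ℕ
    y* = place b₁ b₂ 0 (x a₁) (x a₂)

    y*-sum : y* zero + (y* (suc zero) + y* (suc (suc zero))) ≡ x a₁ + x a₂
    y*-sum = trans (Perm₃-+ y* rows) (cong₂ _+_ (place-p rows 0 (x a₁) (x a₂)) (cong₂ _+_ (place-q rows 0 (x a₁) (x a₂)) (place-s rows 0 (x a₁) (x a₂))))

    v₁* v₂* : ℕ
    v₁* = suc (y* zero)
    v₂* = suc (v₁* + y* (suc zero))

    module _ (xc≡0 : x c ≡ 0) where

      n≡y* : n ≡ suc (suc (y* zero + (y* (suc zero) + y* (suc (suc zero)))))
      n≡y* = trans n≡ (cong (λ z → suc (suc z)) (trans (cong (_+ (x a₁ + x a₂)) xc≡0) (sym y*-sum)))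

      v₁*<v₂* : v₁* < v₂*
      v₁*<v₂* = s≤s (m≤m+n v₁* (y* (suc zero)))

      v₂*≤n : v₂* ≤ n
      v₂*≤n = subst (v₂* ≤_) (sym n≡y*) (s≤s (s≤s (subst (y* zero + y* (suc zero) ≤_) (+-assoc (y* zero) (y* (suc zero)) (y* (suc (suc zero))))
                                                        (m≤m+n (y* zero + y* (suc zero)) (y* (suc (suc zero)))))))

      v₁*∈ : v₁* ∈[1, n ]
      v₁*∈ = s≤s z≤n , ≤-trans (<⇒≤ v₁*<v₂*) v₂*≤n

      v₂*∈ : v₂* ∈[1, n ]
      v₂*∈ = s≤s z≤n , v₂*≤n

      rowSize-v* : ∀ b → rowSize n v₁* v₂* b ≡ y* b
      rowSize-v* zero             = refl
      rowSize-v* (suc zero)       = m+n∸m≡n v₁* (y* (suc zero))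
      rowSize-v* (suc (suc zero)) = trans (cong (_∸ v₂*) n≡y*)
        (trans (cong (λ z → suc (suc z) ∸ v₂*) (sym (+-assoc (y* zero) _ _))) (m+n∸m≡n (y* zero + y* (suc zero)) (y* (suc (suc zero)))))

      fillings-v* : fillings v₁* v₂* ≡ x a₁ ! * x a₂ !
      fillings-v* = begin
        falling 0 (x c) * (falling (rowSize n v₁* v₂* b₁) (x a₁) * falling (rowSize n v₁* v₂* b₂) (x a₂))
          ≡⟨ cong₂ (λ z w → falling 0 z * (falling w (x a₁) * falling (rowSize n v₁* v₂* b₂) (x a₂))) xc≡0 (trans (rowSize-v* b₁) (place-q rows 0 (x a₁) (x a₂))) ⟩
        1 * (falling (x a₁) (x a₁) * falling (rowSize n v₁* v₂* b₂) (x a₂))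
          ≡⟨ cong (λ w → 1 * (falling (x a₁) (x a₁) * falling w (x a₂))) (trans (rowSize-v* b₂) (place-s rows 0 (x a₁) (x a₂))) ⟩
        1 * (falling (x a₁) (x a₁) * falling (x a₂) (x a₂))
          ≡⟨ *-identityˡ _ ⟩
        falling (x a₁) (x a₁) * falling (x a₂) (x a₂)
          ≡⟨ cong₂ _*_ (falling-self (x a₁)) (falling-self (x a₂)) ⟩
        x a₁ ! * x a₂ ! ∎
        where
        open ≡-Reasoning

      -- Rows b₁ and b₂ need at least x a₁ and x a₂ cells, while the three rows have x a₁ + x a₂ cells.
      fillings-support : ∀ {v₁ v₂} → v₁ ∈[1, n ] → v₂ ∈[1, n ] → v₁ < v₂ → fillings v₁ v₂ ≢ 0 → v₁ ≡ v₁* × v₂ ≡ v₂*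
      fillings-support {v₁@(suc a)} {v₂@(suc d)} (1≤v₁ , _) (_ , v₂≤n) v₁<v₂ fillings≢0 = v₁≡v₁* , v₂≡v₂*
        where
        size : Fin 3 → ℕ
        size = rowSize n v₁ v₂
        F₁≢0 : falling (size b₁) (x a₁) ≢ 0
        F₁≢0 eq = fillings≢0 (trans (cong (λ z → falling 0 (x c) * (z * falling (size b₂) (x a₂))) eq) (*-zeroʳ (falling 0 (x c))))
        F₂≢0 : falling (size b₂) (x a₂) ≢ 0
        F₂≢0 eq = fillings≢0 (trans (cong (λ z → falling 0 (x c) * (falling (size b₁) (x a₁) * z)) eq)
                                (trans (cong (falling 0 (x c) *_) (*-zeroʳ (falling (size b₁) (x a₁)))) (*-zeroʳ (falling 0 (x c)))))
        total : size r + (size b₁ + size b₂) ≡ x a₁ + x a₂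
        total = suc-injective (suc-injective (begin
          suc (suc (size r + (size b₁ + size b₂)))       ≡⟨ cong (λ z → suc (suc z)) (Perm₃-+ size rows) ⟨
          suc (suc (size zero + (size (suc zero) + size (suc (suc zero))))) ≡⟨ rowSize-sum 1≤v₁ v₁<v₂ v₂≤n ⟩
          n                                              ≡⟨ n≡ ⟩
          suc (suc (x c + (x a₁ + x a₂)))                ≡⟨ cong (λ z → suc (suc (z + (x a₁ + x a₂)))) xc≡0 ⟩
          suc (suc (x a₁ + x a₂))                        ∎))
          where
          open ≡-Reasoning
        squeezed : size r ≡ 0 × size b₁ ≡ x a₁ × size b₂ ≡ x a₂
        squeezed = squeeze (falling≢0⇒≤ _ _ F₁≢0) (falling≢0⇒≤ _ _ F₂≢0) total
        size≡y* : ∀ b → size b ≡ y* b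
        size≡y* b with place-cases rows 0 (x a₁) (x a₂) b
        ... | inj₁ (refl , y*b≡)        = trans (proj₁ squeezed) (sym y*b≡)
        ... | inj₂ (inj₁ (refl , y*b≡)) = trans (proj₁ (proj₂ squeezed)) (sym y*b≡)
        ... | inj₂ (inj₂ (refl , y*b≡)) = trans (proj₂ (proj₂ squeezed)) (sym y*b≡)
        v₁≡v₁* : v₁ ≡ v₁*
        v₁≡v₁* = cong suc (size≡y* zero)
        v₂≡v₂* : v₂ ≡ v₂*
        v₂≡v₂* = begin
          suc d                      ≡⟨ cong suc (m+[n∸m]≡n (≤-pred v₁<v₂)) ⟨
          suc (v₁ + size (suc zero)) ≡⟨ cong₂ (λ p q → suc (p + q)) v₁≡v₁* (size≡y* (suc zero)) ⟩
          v₂*                        ∎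
          where
          open ≡-Reasoning

    ∑-fillings : (∑ (range1 n) λ v₁ → ∑ (range1 n) λ v₂ → ⟦ v₁ <ᵇ v₂ ⟧ * fillings v₁ v₂) ≡ falling 0 (x c) * (x a₁ ! * x a₂ !)
    ∑-fillings with x c ≟ 0
    ... | yes xc≡0 = begin
      (∑ (range1 n) λ v₁ → ∑ (range1 n) λ v₂ → ⟦ v₁ <ᵇ v₂ ⟧ * fillings v₁ v₂)
        ≡⟨ ∑-range1-single₂ n fillings (v₁*∈ xc≡0) (v₂*∈ xc≡0) (v₁*<v₂* xc≡0) (fillings-support xc≡0) ⟩
      fillings v₁* v₂*
        ≡⟨ fillings-v* xc≡0 ⟩
      x a₁ ! * x a₂ !
        ≡⟨ *-identityˡ _ ⟨
      falling 0 0 * (x a₁ ! * x a₂ !)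
        ≡⟨ cong (λ z → falling 0 z * (x a₁ ! * x a₂ !)) xc≡0 ⟨
      falling 0 (x c) * (x a₁ ! * x a₂ !) ∎
      where
      open ≡-Reasoning
    ... | no xc≢0 = trans (∑-range1-zero n _ λ {v₁} _ → ∑-range1-zero n _ λ {v₂} _ → trans (cong (λ z → ⟦ v₁ <ᵇ v₂ ⟧ * (z * (falling (rowSize n v₁ v₂ b₁) (x a₁) * falling (rowSize n v₁ v₂ b₂) (x a₂)))) F₀≡0) (*-zeroʳ ⟦ v₁ <ᵇ v₂ ⟧))
                          (sym (cong (_* (x a₁ ! * x a₂ !)) F₀≡0))
      where
      F₀≡0 : falling 0 (x c) ≡ 0
      F₀≡0 = falling-0 xc≢0

  occurrencesAt-blocks : ∀ x₀ x₁ x₂ → occurrencesAt R (x₀ + suc (x₁ + suc x₂)) (suc x₀) (suc (suc (x₀ + x₁)))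
    ≡ falling 0 (pick c x₀ x₁ x₂) * (pick a₁ x₀ x₁ x₂ ! * pick a₂ x₀ x₁ x₂ !)
  occurrencesAt-blocks x₀ x₁ x₂ =
    trans (occurrencesAt-rows x₀ x₁ x₂)
          (trans (∑-range1-cong n λ {v₁} v₁∈ → ∑-range1-cong n λ {v₂} v₂∈ → cong (⟦ v₁ <ᵇ v₂ ⟧ *_) (product≡fillings v₁∈ v₂∈)) ∑-fillings)
    where
    open ColumnSizes x₀ x₁ x₂

  occurrencesAt-value : ∀ n {i j} → i ∈[1, n ] → j ∈[1, n ] → occurrencesAt R n i j ≡ ⟦ i <ᵇ j ⟧ * weight c (i ∸ 1) (j ∸ suc i) (n ∸ j)
  occurrencesAt-value n {i} {j} _ _ with i <? j
  ... | no i≮j = begin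
    ∑ (perms n) (λ π → ⟦ (i <ᵇ j) ∧ ((at π i <ᵇ at π j) ∧ all (boxEmpty π i j) R) ⟧)
      ≡⟨ ∑-cong (perms n) (λ π → cong (λ b → ⟦ b ∧ ((at π i <ᵇ at π j) ∧ all (boxEmpty π i j) R) ⟧) i<ᵇj≡false) ⟩
    ∑ (perms n) (λ _ → 0)
      ≡⟨ ∑-zero (perms n) ⟩
    0
      ≡⟨ cong (λ b → ⟦ b ⟧ * weight c (i ∸ 1) (j ∸ suc i) (n ∸ j)) i<ᵇj≡false ⟨
    ⟦ i <ᵇ j ⟧ * weight c (i ∸ 1) (j ∸ suc i) (n ∸ j) ∎
    where
    open ≡-Reasoning
    i<ᵇj≡false : (i <ᵇ j) ≡ false
    i<ᵇj≡false = dec-false (i <? j) i≮j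
  occurrencesAt-value n {suc x₀} {j} (s≤s z≤n , _) (_ , j≤n) | yes i<j with m≤n⇒∃[o]m+o≡n i<j | m≤n⇒∃[o]m+o≡n j≤n
  ... | x₁ , refl | x₂ , refl = begin
    occurrencesAt R (suc (suc (x₀ + x₁)) + x₂) (suc x₀) (suc (suc (x₀ + x₁)))
      ≡⟨ cong (λ m → occurrencesAt R m (suc x₀) (suc (suc (x₀ + x₁)))) n≡ ⟩
    occurrencesAt R (x₀ + suc (x₁ + suc x₂)) (suc x₀) (suc (suc (x₀ + x₁)))
      ≡⟨ occurrencesAt-blocks x₀ x₁ x₂ ⟩
    falling 0 (pick c x₀ x₁ x₂) * (pick a₁ x₀ x₁ x₂ ! * pick a₂ x₀ x₁ x₂ !)
      ≡⟨ weight-Perm₃ columns x₀ x₁ x₂ ⟩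
    weight c x₀ x₁ x₂
      ≡⟨ cong₂ (weight c x₀) (m+n∸m≡n (suc (suc x₀)) x₁) (m+n∸m≡n (suc (suc (x₀ + x₁))) x₂) ⟨
    weight c x₀ (suc (suc x₀) + x₁ ∸ suc (suc x₀)) (suc (suc (x₀ + x₁)) + x₂ ∸ suc (suc (x₀ + x₁)))
      ≡⟨ *-identityˡ _ ⟨
    1 * weight c x₀ (suc (suc x₀) + x₁ ∸ suc (suc x₀)) (suc (suc (x₀ + x₁)) + x₂ ∸ suc (suc (x₀ + x₁)))
      ≡⟨ cong (λ b → ⟦ b ⟧ * weight c x₀ (suc (suc x₀) + x₁ ∸ suc (suc x₀)) (suc (suc (x₀ + x₁)) + x₂ ∸ suc (suc (x₀ + x₁)))) (dec-true (suc x₀ <? suc (suc (x₀ + x₁))) i<j) ⟨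
    ⟦ suc x₀ <ᵇ suc (suc (x₀ + x₁)) ⟧ * weight c x₀ (suc (suc x₀) + x₁ ∸ suc (suc x₀)) (suc (suc (x₀ + x₁)) + x₂ ∸ suc (suc (x₀ + x₁))) ∎
    where
    open ≡-Reasoning
    n≡ : suc (suc (x₀ + x₁)) + x₂ ≡ x₀ + suc (x₁ + suc x₂)
    n≡ = trans (cong (suc ∘′ suc) (+-assoc x₀ x₁ x₂)) (sym (+-suc-suc x₀ x₁ x₂))

  ∑-occ : ∀ n → ∑ (perms n) (occ R) ≡ A n
  ∑-occ n = begin
    ∑ (perms n) (occ R)
      ≡⟨ ∑-cong-All (perms-IsWord n) (λ {π} (len , _) → trans (occ≡∑ R π) (cong (λ m → ∑ (range1 m) λ i → ∑ (range1 m) λ j → ⟦ isOcc R π i j ⟧) len)) ⟩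
    (∑ (perms n) λ π → ∑ V λ i → ∑ V λ j → ⟦ isOcc R π i j ⟧)
      ≡⟨ ∑-comm (perms n) V _ ⟩
    (∑ V λ i → ∑ (perms n) λ π → ∑ V λ j → ⟦ isOcc R π i j ⟧)
      ≡⟨ ∑-cong V (λ i → ∑-comm (perms n) V _) ⟩
    (∑ V λ i → ∑ V λ j → occurrencesAt R n i j)
      ≡⟨ ∑-range1-cong n (λ i∈ → ∑-range1-cong n λ j∈ → occurrencesAt-value n i∈ j∈) ⟩
    (∑ V λ i → ∑ V λ j → ⟦ i <ᵇ j ⟧ * weight c (i ∸ 1) (j ∸ suc i) (n ∸ j))
      ≡⟨ ∑-positions c n ⟩
    A n ∎
    where
    open ≡-Reasoning
    V : List ℕ
    V = range1 n

  module _ (u₀ : List ℕ) (v₁ : ℕ) (u₁ : List ℕ) (v₂ : ℕ) (u₂ : List ℕ) where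
    open Characterisation u₀ v₁ u₁ v₂ u₂

    emptyStrips : All (_∈[1, n ]) word → Unique word → T (isOcc R word i j) → EmptyStrip c n i j × EmptyStrip r n v₁ v₂
    emptyStrips word∈ unique occurs =
        emptyBlock⇒EmptyStrip c (nothing-fits (subst (λ m → All (λ y → T (inRowᵐ n v₁ v₂ m y)) (block c)) ρ-c (proj₂ (fitting c))))
      , emptyStrip r row-r-empty (All.lookup word∈ (∈-++⁺ʳ u₀ (here refl))) (All.lookup word∈ (∈-++⁺ʳ u₀ (there (∈-++⁺ʳ u₁ (here refl)))))
      where
      lt×empty : T (v₁ <ᵇ v₂) × T (all emptyBox R)
      lt×empty = Equivalence.to T-∧ (subst T (isOcc-blocks R) occurs)
      v₁<v₂ : v₁ < v₂
      v₁<v₂ = <ᵇ⇒< v₁ v₂ (proj₁ lt×empty)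
      open Rows n v₁ v₂ v₁<v₂
      fitting : ∀ a → Fits a
      fitting = fits-if-occurrence word∈ unique v₁<v₂ (Equivalence.to shadedEmpty⇔ (proj₂ lt×empty))
      nothing-fits : ∀ {xs} → All (λ y → T (inRowᵐ n v₁ v₂ nothing y)) xs → xs ≡ []
      nothing-fits []      = refl
      row-r-empty : ∀ {y} → y ∈[1, n ] → ¬ InRow r y
      row-r-empty y∈ y∈r with ∈-word⁻ (perm-surjective (refl , word∈) unique y∈)
      ... | inj₁ y≡v₁ = inRow⇒≢v₁ r y∈r y≡v₁
      ... | inj₂ (inj₁ y≡v₂) = inRow⇒≢v₂ r y∈r y≡v₂
      ... | inj₂ (inj₂ (a , y∈a)) with InFreeRow⇒ (All.lookup (proj₂ (fitting a)) y∈a)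
      ...   | b , ρa≡b , y∈b rewrite inRow-unique b r y∈b y∈r = ρ-≢r a ρa≡b

  occurrence⇒emptyStrips : ∀ {n π} → IsWord n n π → Unique π → ∀ {i j} → i ∈[1, n ] → j ∈[1, n ] → T (isOcc R π i j) →
    EmptyStrip c n i j × EmptyStrip r n (at π i) (at π j)
  occurrence⇒emptyStrips {π = π} (refl , π∈) unique {suc i₀} {j} (s≤s z≤n , i≤n) (_ , j≤n) occurs
    with m≤n⇒∃[o]m+o≡n (<ᵇ⇒< (suc i₀) j (proj₁ (Equivalence.to T-∧ occurs)))
  ... | d , refl with split-at π i₀ i≤n
  ... | u₀ , v₁ , w₁ , refl , refl with split-at w₁ d (d<length (length w₁) (subst (suc (suc (length u₀ + d)) ≤_) (length-++ u₀) j≤n))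
    where
    d<length : ∀ m → suc (suc (length u₀ + d)) ≤ length u₀ + suc m → d < m
    d<length m le = s≤s⁻¹ (+-cancelˡ-≤ (length u₀) _ _
      (subst (_≤ length u₀ + suc m) (sym (trans (+-suc (length u₀) (suc d)) (cong suc (+-suc (length u₀) d)))) le))
  ... | u₁ , v₂ , u₂ , refl , refl =
    let (column , row) = emptyStrips u₀ v₁ u₁ v₂ u₂ π∈ unique occurs
    in column , subst₂ (EmptyStrip r _) (sym at-i) (sym at-j) row
    where
    open Blocks u₀ v₁ u₁ v₂ u₂ using (at-i; at-j)

  occ≤1-perm : ∀ {n π} → IsWord n n π → Unique π → occ R π ≤ 1
  occ≤1-perm {π = π} isWord@(refl , _) unique = occ≤1 R π λ i∈ j∈ i′∈ j′∈ occurs occurs′ →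
    let (column , row) = occurrence⇒emptyStrips isWord unique i∈ j∈ occurs
        (column′ , row′) = occurrence⇒emptyStrips isWord unique i′∈ j′∈ occurs′
    in strips-determine c≢r (at π) (at-injective unique) i∈ j∈ i′∈ j′∈ column column′ row row′

  occ-perms≤1 : ∀ n → All (λ π → occ R π ≤ 1) (perms n)
  occ-perms≤1 n = All.zipWith (λ (isWord , unique) → occ≤1-perm isWord unique) (perms-IsWord n , perms-Unique n)

  genPoly≡ : ∀ n q → genPoly R n q ≡ (n ! ∸ A n) + q * A n
  genPoly≡ n q = begin
    genPoly R n q                                       ≡⟨ sum-map (perms n) _ ⟩
    ∑ (perms n) (λ π → q ^ occ R π)                     ≡⟨ ∑-^-01 (occ R) (occ-perms≤1 n) q ⟩
    (length (perms n) ∸ ∑ (perms n) (occ R)) + q * ∑ (perms n) (occ R)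
      ≡⟨ cong₂ (λ N S → (N ∸ S) + q * S) (length-perms n) (∑-occ n) ⟩
    (n ! ∸ A n) + q * A n                               ∎
    where
    open ≡-Reasoning

  s≡ : ∀ n k → s R n k ≡ distribution01 (n !) (A n) k
  s≡ n k = trans (count-01 (occ R) (occ-perms≤1 n) k) (cong₂ (λ N S → distribution01 N S k) (length-perms n) (∑-occ n))

shape : (k : Fin 12) → Shape (patt k)
shape zero = twoFree p012 p210 (λ ())
shape (suc zero) = twoFree p201 p021 (λ ())
shape (suc (suc zero)) = twoFree p102 p210 (λ ())
shape (suc (suc (suc zero))) = twoFree p012 p120 (λ ())
shape (suc (suc (suc (suc zero)))) = twoFree p201 p120 (λ ())
shape (suc (suc (suc (suc (suc zero))))) = twoFree p102 p021 (λ ())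
shape (suc (suc (suc (suc (suc (suc zero)))))) = twoFree p012 p201 (λ ())
shape (suc (suc (suc (suc (suc (suc (suc zero))))))) = twoFree p201 p012 (λ ())
shape (suc (suc (suc (suc (suc (suc (suc (suc zero)))))))) = twoFree p012 p102 (λ ())
shape (suc (suc (suc (suc (suc (suc (suc (suc (suc zero))))))))) = twoFree p102 p201 (λ ())
shape (suc (suc (suc (suc (suc (suc (suc (suc (suc (suc zero)))))))))) = twoFree p201 p102 (λ ())
shape (suc (suc (suc (suc (suc (suc (suc (suc (suc (suc (suc zero))))))))))) = twoFree p102 p012 (λ ())

theorem3p2 : ((i j : Fin 12) → Equidistributed (patt i) (patt j))
             × ((i : Fin 12) → (n : ℕ) → 1 ≤ n → (q : ℕ)
                 → genPoly (patt i) n q ≡ (n ! ∸ A n) + q * A n)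
theorem3p2 = (λ i j n k → trans (Occurrences.s≡ (shape i) n k) (sym (Occurrences.s≡ (shape j) n k)))
           -- The formula also holds for n = 0.
           , (λ i n _ q → Occurrences.genPoly≡ (shape i) n q)
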